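{- Let $\delta=\delta(n) \to 1$ as $n \to \infty$. Then \[ (f^+(n,\delta)/n!)^{1/n} = \Theta(\max \{1-\delta, 1/n\}). \]
   Context: For a finite poset $Q_n$ on $n$ points, $e(Q_n)$ denotes its number of linear extensions and $\mathrm{comp}(Q_n)$ denotes the number of edges in its comparability graph (the number of comparable pairs). For a positive integer $n$ and $0<\delta<1$, $f^+(n,\delta)= \max \{ e(Q_n): \mathrm{comp}(Q_n) \geq \delta \binom{n}{2} \}$.
   Formalization: The sequence $\delta(n)$ takes rational values. -}

module Defs where

open import Data.Nat as ℕ using (ℕ; zero; suc; _<ᵇ_; _≡ᵇ_; _+_)
open import Data.Nat.Combinatorics using (_C_)
open import Data.Nat using (_!)
open import Data.Fin using (Fin; toℕ)
open import Data.Vec using (Vec; []; _∷_; lookup)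
open import Data.List using (List; []; _∷_; map; concatMap; filter; length; allFin)
open import Data.Nat.ListAction using (sum)
open import Data.Bool using (Bool; true; false; _∧_; _∨_; not; if_then_else_; T)
open import Data.Integer using (+_)
open import Data.Rational using (ℚ; _/_; _*_; 1ℚ; 0ℚ; _-_; _⊔_)
open import Relation.Binary.PropositionalEquality using (_≡_)
open import Relation.Nullary.Decidable using (T?)

record FinPoset (n : ℕ) : Set where
  field
    le      : Fin n → Fin n → Bool
    refl    : ∀ i → le i i ≡ true
    antisym : ∀ i j → le i j ≡ true → le j i ≡ true → i ≡ j
    trans   : ∀ i j k → le i j ≡ true → le j k ≡ true → le i k ≡ true
open FinPoset public

_=ꟳ_ : ∀ {n} → Fin n → Fin n → Bool
i =ꟳ j = toℕ i ≡ᵇ toℕ j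

_<ꟳ_ : ∀ {n} → Fin n → Fin n → Bool
i <ꟳ j = toℕ i <ᵇ toℕ j

allB : ∀ {A : Set} → (A → Bool) → List A → Bool
allB p []       = true
allB p (x ∷ xs) = p x ∧ allB p xs

allVecs : (n k : ℕ) → List (Vec (Fin n) k)
allVecs n zero    = [] ∷ []
allVecs n (suc k) = concatMap (λ x → map (x ∷_) (allVecs n k)) (allFin n)

-- A linear extension of Q is a bijection σ : points → positions {0..n-1}
-- (given as the vector of positions; injective, hence bijective) such that i ≤_Q j implies σ i ≤ σ j.
isLinExt : ∀ {n} → FinPoset n → Vec (Fin n) n → Bool
isLinExt {n} Q σ =
  allB (λ i → allB (λ j →
      (i =ꟳ j ∨ not (lookup σ i =ꟳ lookup σ j))
    ∧ (not (le Q i j) ∨ not (lookup σ j <ꟳ lookup σ i)))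
    (allFin n)) (allFin n)

e : ∀ {n} → FinPoset n → ℕ
e {n} Q = length (filter (λ σ → T? (isLinExt Q σ)) (allVecs n n))

comp : ∀ {n} → FinPoset n → ℕ
comp {n} Q = sum (map (λ i → sum (map (λ j →
    if (i <ꟳ j) ∧ (le Q i j ∨ le Q j i) then 1 else 0) (allFin n))) (allFin n))

ℕtoℚ : ℕ → ℚ
ℕtoℚ n = + n / 1

_^ℚ_ : ℚ → ℕ → ℚ
q ^ℚ zero  = 1ℚ
q ^ℚ suc k = q * (q ^ℚ k)

-- 1/n for n ≥ 1 (value at n = 0 is irrelevant, set to 0)
inv : ℕ → ℚ
inv zero    = 0ℚ
inv (suc k) = + 1 / suc k

M : ℚ → ℕ → ℚ
M δ n = (1ℚ - δ) ⊔ inv n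

δbinom : ℚ → ℕ → ℚ
δbinom δ n = δ * ℕtoℚ (n C 2)

module Submission where

-- Upper bound: in a linear extension the position of x lies in an interval of
-- length s(x) = n - |strict down-set| - |strict up-set|, so e(Q) ≤ ∏ s(x), while
-- ∑ s(x) ≤ n² - 2·comp(Q) ≤ (1-δ)n² + δn.  With a = ⌊∑ s / n⌋ + 1 ≤ 3Mn the crude
-- AM-GM bound x ≤ a·2^⌊x/a⌋ gives e(Q) ≤ (2a)^n ≤ (6Mn)^n ≤ (24M)^n n!, as n^n ≤ 4^n n!.
-- Lower bound: let Q be the weak order whose levels are consecutive blocks of
-- k = t + 1 points, where 2t ≤ (1-δ)(n-1) < 2t + 2.  It misses at most nt ≤ (1-δ)·C(n,2)
-- comparable pairs and has e(Q) = ∏ (1 + i mod k) ≥ (k/8)^n ≥ (Mn/24)^n ≥ (M/24)^n n!.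

open import Defs hiding (refl; trans)
open import Data.Nat.Base using (ℕ; NonZero)

module Booleans where

  open import Data.Nat.Base using (zero; suc; _<_; _<ᵇ_)
  open import Data.Nat.Properties using (≡ᵇ⇒≡; ≡⇒≡ᵇ; <ᵇ⇒<; <⇒<ᵇ)
  open import Data.Bool.Base using (Bool; true; false; _∧_; _∨_; not; T)
  open import Data.Bool.Properties using (T-≡)
  open import Data.Fin.Base using (Fin; toℕ; zero; suc)
  open import Data.Fin.Properties using (toℕ-injective)
  open import Data.List.Base using (tabulate)
  open import Data.Empty using (⊥; ⊥-elim)
  open import Function using (Equivalence; _∘_)
  open import Relation.Binary.PropositionalEquality

  true≢false : true ≡ false → ⊥
  true≢false ()

  ≢true⇒≡false : ∀ {b} → (b ≡ true → ⊥) → b ≡ false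
  ≢true⇒≡false {true}  h = ⊥-elim (h refl)
  ≢true⇒≡false {false} h = refl

  ∧-trueˡ : ∀ {a b} → a ∧ b ≡ true → a ≡ true
  ∧-trueˡ {true} _ = refl

  ∧-trueʳ : ∀ {a b} → a ∧ b ≡ true → b ≡ true
  ∧-trueʳ {true} h = h

  ∧-true : ∀ {a b} → a ≡ true → b ≡ true → a ∧ b ≡ true
  ∧-true refl refl = refl

  ∨-trueˡ : ∀ {a b} → a ≡ true → a ∨ b ≡ true
  ∨-trueˡ refl = refl

  ∨-trueʳ : ∀ {a b} → b ≡ true → a ∨ b ≡ true
  ∨-trueʳ {true}  _ = refl
  ∨-trueʳ {false} h = h

  ∨-resolveˡ : ∀ {a b} → a ∨ b ≡ true → a ≡ false → b ≡ true
  ∨-resolveˡ {false} h refl = h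

  ∨-resolveʳ : ∀ {a b} → a ∨ b ≡ true → b ≡ false → a ≡ true
  ∨-resolveʳ {true}  _ _    = refl
  ∨-resolveʳ {false} h refl = h

  not-false : ∀ {a} → a ≡ false → not a ≡ true
  not-false refl = refl

  not-true : ∀ {a} → not a ≡ true → a ≡ false
  not-true {false} _ = refl

  T⇒≡true : ∀ {b} → T b → b ≡ true
  T⇒≡true = Equivalence.to T-≡

  ≡true⇒T : ∀ {b} → b ≡ true → T b
  ≡true⇒T = Equivalence.from T-≡

  =ꟳ⇒≡ : ∀ {n} {i j : Fin n} → (i =ꟳ j) ≡ true → i ≡ j
  =ꟳ⇒≡ {i = i} {j} h = toℕ-injective (≡ᵇ⇒≡ (toℕ i) (toℕ j) (≡true⇒T h))

  ≡⇒=ꟳ : ∀ {n} {i j : Fin n} → i ≡ j → (i =ꟳ j) ≡ true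
  ≡⇒=ꟳ {i = i} {j} e = T⇒≡true (≡⇒≡ᵇ (toℕ i) (toℕ j) (cong toℕ e))

  <ᵇ⇒<′ : ∀ {a b} → (a <ᵇ b) ≡ true → a < b
  <ᵇ⇒<′ {a} {b} h = <ᵇ⇒< a b (≡true⇒T h)

  <⇒<ᵇ′ : ∀ {a b} → a < b → (a <ᵇ b) ≡ true
  <⇒<ᵇ′ h = T⇒≡true (<⇒<ᵇ h)

  <ꟳ⇒< : ∀ {n} {i j : Fin n} → (i <ꟳ j) ≡ true → toℕ i < toℕ j
  <ꟳ⇒< = <ᵇ⇒<′

  allB-tabulate⁻ : ∀ {A : Set} {n} (p : A → Bool) (g : Fin n → A) →
    allB p (tabulate g) ≡ true → ∀ i → p (g i) ≡ true
  allB-tabulate⁻ p g h zero    = ∧-trueˡ h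
  allB-tabulate⁻ p g h (suc i) = allB-tabulate⁻ p (g ∘ suc) (∧-trueʳ {p (g zero)} h) i

  allB-tabulate⁺ : ∀ {A : Set} {n} (p : A → Bool) (g : Fin n → A) →
    (∀ i → p (g i) ≡ true) → allB p (tabulate g) ≡ true
  allB-tabulate⁺ {n = zero}  p g h = refl
  allB-tabulate⁺ {n = suc n} p g h = ∧-true (h zero) (allB-tabulate⁺ p (g ∘ suc) (h ∘ suc))

  ≮⇒<ᵇ-false : ∀ {a b} → (a < b → ⊥) → (a <ᵇ b) ≡ false
  ≮⇒<ᵇ-false h = ≢true⇒≡false (λ e → h (<ᵇ⇒<′ e))

module Sums where

  open import Data.Nat
  open import Data.Nat.Properties
  open import Data.Bool.Base using (Bool; true; false; _∧_)
  open import Data.Bool.Properties using (∧-zeroʳ; ∧-identityʳ)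
  open import Data.Nat.Combinatorics using (_C_; nC1≡n; nCk+nC[k+1]≡[n+1]C[k+1])
  open import Data.Nat.Tactic.RingSolver using (solve-∀)
  open import Data.Fin.Base using (Fin; toℕ; zero; suc)
  open import Data.Fin.Properties using () renaming (0≢1+n to Fin-0≢1+n; suc-injective to Fin-suc-injective)
  open import Data.Vec.Base using (Vec; []; _∷_; lookup)
  open import Data.List.Base using (List; []; _∷_; map; concatMap; allFin; tabulate; filter; length; _++_)
  open import Data.List.Properties using (map-++; map-tabulate)
  open import Data.Nat.ListAction using (sum)
  open import Data.Nat.ListAction.Properties using (sum-++)
  open import Algebra.Properties.Semiring.Sum +-*-semiring
    using (sum-syntax; sum-cong-≗; ∑-distrib-+; ∑-comm; *-distribʳ-sum)
  open import Relation.Nullary.Decidable using (T?)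
  open import Relation.Binary.PropositionalEquality
  open import Function using (_∘_)
  open Booleans

  𝟙 : Bool → ℕ
  𝟙 true  = 1
  𝟙 false = 0

  𝟙≤1 : ∀ b → 𝟙 b ≤ 1
  𝟙≤1 true  = s≤s z≤n
  𝟙≤1 false = z≤n

  𝟙-∧ : ∀ a b → 𝟙 (a ∧ b) ≡ 𝟙 a * 𝟙 b
  𝟙-∧ true  b = sym (+-identityʳ (𝟙 b))
  𝟙-∧ false b = refl

  𝟙-mono : ∀ {a b} → (a ≡ true → b ≡ true) → 𝟙 a ≤ 𝟙 b
  𝟙-mono {false} h = z≤n
  𝟙-mono {true}  h rewrite h refl = ≤-refl

  ∑-mono-≤ : ∀ {n} {f g : Fin n → ℕ} → (∀ i → f i ≤ g i) → ∑[ i < n ] f i ≤ ∑[ i < n ] g i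
  ∑-mono-≤ {zero}  h = z≤n
  ∑-mono-≤ {suc n} h = +-mono-≤ (h zero) (∑-mono-≤ (h ∘ suc))

  ∑-const : ∀ n c → ∑[ i < n ] c ≡ n * c
  ∑-const zero    c = refl
  ∑-const (suc n) c = cong (c +_) (∑-const n c)

  ∑-zero : ∀ n {f : Fin n → ℕ} → (∀ i → f i ≡ 0) → ∑[ i < n ] f i ≡ 0
  ∑-zero n h = trans (sum-cong-≗ h) (trans (∑-const n 0) (*-zeroʳ n))

  ∑-*ʳ : ∀ {n} c (f : Fin n → ℕ) → ∑[ i < n ] (f i * c) ≡ (∑[ i < n ] f i) * c
  ∑-*ʳ c f = sym (*-distribʳ-sum c f)

  sum-map-allFin : ∀ n (f : Fin n → ℕ) → sum (map f (allFin n)) ≡ ∑[ i < n ] f i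
  sum-map-allFin n f = trans (cong sum (map-tabulate (λ i → i) f)) (sum-tabulate n f)
    where
    sum-tabulate : ∀ n (f : Fin n → ℕ) → sum (tabulate f) ≡ ∑[ i < n ] f i
    sum-tabulate zero    f = refl
    sum-tabulate (suc n) f = cong (f zero +_) (sum-tabulate n (f ∘ suc))

  ∑ℕ : ℕ → (ℕ → ℕ) → ℕ
  ∑ℕ zero    g = 0
  ∑ℕ (suc n) g = g 0 + ∑ℕ n (g ∘ suc)

  ∑-toℕ : ∀ n (g : ℕ → ℕ) → ∑[ i < n ] g (toℕ i) ≡ ∑ℕ n g
  ∑-toℕ zero    g = refl
  ∑-toℕ (suc n) g = cong (g 0 +_) (∑-toℕ n (g ∘ suc))

  ∑ℕ-zero : ∀ n g → (∀ i → g i ≡ 0) → ∑ℕ n g ≡ 0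
  ∑ℕ-zero zero    g h = refl
  ∑ℕ-zero (suc n) g h = cong₂ _+_ (h 0) (∑ℕ-zero n (g ∘ suc) (h ∘ suc))

  ∑ℕ-+ : ∀ a b g → ∑ℕ (a + b) g ≡ ∑ℕ a g + ∑ℕ b (λ i → g (a + i))
  ∑ℕ-+ zero    b g = refl
  ∑ℕ-+ (suc a) b g = trans (cong (g 0 +_) (∑ℕ-+ a b (g ∘ suc))) (sym (+-assoc (g 0) _ _))

  ∑ℕ-cong : ∀ n {f g : ℕ → ℕ} → (∀ i → i < n → f i ≡ g i) → ∑ℕ n f ≡ ∑ℕ n g
  ∑ℕ-cong zero    h = refl
  ∑ℕ-cong (suc n) h = cong₂ _+_ (h 0 z<s) (∑ℕ-cong n (λ i i<n → h (suc i) (s<s i<n)))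

  ∑ℕ-mono-≤ : ∀ n {f g : ℕ → ℕ} → (∀ i → i < n → f i ≤ g i) → ∑ℕ n f ≤ ∑ℕ n g
  ∑ℕ-mono-≤ zero    h = z≤n
  ∑ℕ-mono-≤ (suc n) h = +-mono-≤ (h 0 z<s) (∑ℕ-mono-≤ n (λ i i<n → h (suc i) (s<s i<n)))

  ∑ℕ-monoˡ-≤ : ∀ {a b} g → a ≤ b → ∑ℕ a g ≤ ∑ℕ b g
  ∑ℕ-monoˡ-≤ {a} {b} g a≤b = begin
    ∑ℕ a g                                 ≤⟨ m≤m+n _ _ ⟩
    ∑ℕ a g + ∑ℕ (b ∸ a) (λ i → g (a + i))  ≡⟨ ∑ℕ-+ a (b ∸ a) g ⟨
    ∑ℕ (a + (b ∸ a)) g                     ≡⟨ cong (λ c → ∑ℕ c g) (m+[n∸m]≡n a≤b) ⟩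
    ∑ℕ b g                                 ∎
    where open ≤-Reasoning

  -- a ≤ p < b, with a ≤ p written as a < suc p so that shifting a, b and p by one computes.
  inRange : ℕ → ℕ → ℕ → Bool
  inRange a b p = (a <ᵇ suc p) ∧ (p <ᵇ b)

  ∑ℕ-inRange : ∀ n a b → b ≤ n → ∑ℕ n (𝟙 ∘ inRange a b) ≡ b ∸ a
  ∑ℕ-inRange zero    a       zero    z≤n       = sym (0∸n≡0 a)
  ∑ℕ-inRange (suc n) a       zero    _         =
    trans (∑ℕ-zero (suc n) _ (λ p → cong 𝟙 (∧-zeroʳ (a <ᵇ suc p)))) (sym (0∸n≡0 a))
  ∑ℕ-inRange (suc n) zero    (suc b) (s≤s b≤n) = cong suc (∑ℕ-inRange n zero b b≤n)
  ∑ℕ-inRange (suc n) (suc a) (suc b) (s≤s b≤n) = ∑ℕ-inRange n a b b≤n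

  ∑ℕ-inRange-≤ : ∀ n a b → ∑ℕ n (𝟙 ∘ inRange a b) ≤ b ∸ a
  ∑ℕ-inRange-≤ zero    a       b       = z≤n
  ∑ℕ-inRange-≤ (suc n) a       zero    = ≤-reflexive (∑ℕ-inRange (suc n) a zero z≤n)
  ∑ℕ-inRange-≤ (suc n) zero    (suc b) = s≤s (∑ℕ-inRange-≤ n zero b)
  ∑ℕ-inRange-≤ (suc n) (suc a) (suc b) = ∑ℕ-inRange-≤ n a b

  ∑-inRange : ∀ n a b → b ≤ n → ∑[ p < n ] 𝟙 (inRange a b (toℕ p)) ≡ b ∸ a
  ∑-inRange n a b b≤n = trans (∑-toℕ n (𝟙 ∘ inRange a b)) (∑ℕ-inRange n a b b≤n)

  ∑ℕ[n∸1+i]≡nC2 : ∀ n → ∑ℕ n (λ i → n ∸ suc i) ≡ n C 2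
  ∑ℕ[n∸1+i]≡nC2 zero    = refl
  ∑ℕ[n∸1+i]≡nC2 (suc n) = trans (cong (n +_) (∑ℕ[n∸1+i]≡nC2 n))
    (trans (cong (_+ n C 2) (sym (nC1≡n n))) (nCk+nC[k+1]≡[n+1]C[k+1] n 1))

  [1+m]C2+[1+m]C2≡[1+m]*m : ∀ m → suc m C 2 + suc m C 2 ≡ suc m * m
  [1+m]C2+[1+m]C2≡[1+m]*m zero    = refl
  [1+m]C2+[1+m]C2≡[1+m]*m (suc m) = begin
    suc (suc m) C 2 + suc (suc m) C 2          ≡⟨ cong (λ c → c + c) pascal ⟨
    (suc m + suc m C 2) + (suc m + suc m C 2)  ≡⟨ regroup (suc m) (suc m C 2) ⟩
    (suc m + suc m) + (suc m C 2 + suc m C 2)  ≡⟨ cong ((suc m + suc m) +_) ([1+m]C2+[1+m]C2≡[1+m]*m m) ⟩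
    (suc m + suc m) + suc m * m                ≡⟨ expand m ⟩
    suc (suc m) * suc m                        ∎
    where
    open ≡-Reasoning
    pascal : suc m + suc m C 2 ≡ suc (suc m) C 2
    pascal = trans (cong (_+ suc m C 2) (sym (nC1≡n (suc m)))) (nCk+nC[k+1]≡[n+1]C[k+1] (suc m) 1)
    regroup : ∀ a c → (a + c) + (a + c) ≡ (a + a) + (c + c)
    regroup = solve-∀
    expand : ∀ m → (suc m + suc m) + suc m * m ≡ suc (suc m) * suc m
    expand = solve-∀

  ∑∑𝟙[i<j]≡nC2 : ∀ n → ∑[ i < n ] ∑[ j < n ] 𝟙 (i <ꟳ j) ≡ n C 2
  ∑∑𝟙[i<j]≡nC2 n = begin
    ∑[ i < n ] ∑[ j < n ] 𝟙 (i <ꟳ j)     ≡⟨ sum-cong-≗ {n} (λ i → trans (∑-toℕ n _) (∑ℕ-cong n (λ p p<n → cong 𝟙 (sym (∧-identityʳ′ (<⇒<ᵇ′ p<n)))))) ⟩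
    ∑[ i < n ] ∑ℕ n (𝟙 ∘ inRange (suc (toℕ i)) n)
                                         ≡⟨ sum-cong-≗ {n} (λ i → ∑ℕ-inRange n (suc (toℕ i)) n ≤-refl) ⟩
    ∑[ i < n ] (n ∸ suc (toℕ i))         ≡⟨ ∑-toℕ n (λ i → n ∸ suc i) ⟩
    ∑ℕ n (λ i → n ∸ suc i)               ≡⟨ ∑ℕ[n∸1+i]≡nC2 n ⟩
    n C 2                                ∎
    where
    open ≡-Reasoning
    ∧-identityʳ′ : ∀ {a b} → b ≡ true → a ∧ b ≡ a
    ∧-identityʳ′ {a} refl = ∧-identityʳ a

  ∑-𝟙-=ꟳ : ∀ {m} (y : Fin m) → ∑[ p < m ] 𝟙 (y =ꟳ p) ≡ 1
  ∑-𝟙-=ꟳ {suc m} zero    = cong suc (∑-zero m (λ _ → refl))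
  ∑-𝟙-=ꟳ {suc m} (suc y) = ∑-𝟙-=ꟳ y

  ∑-𝟙-atMostOne : ∀ {n} (g : Fin n → Bool) b →
    (∀ j j′ → g j ≡ true → g j′ ≡ true → j ≡ j′) → (∀ j → g j ≡ true → b ≡ true) →
    ∑[ j < n ] 𝟙 (g j) ≤ 𝟙 b
  ∑-𝟙-atMostOne {zero}  g b unique implies = z≤n
  ∑-𝟙-atMostOne {suc n} g b unique implies with g zero in g0
  ... | true  rewrite implies zero g0 =
    s≤s (≤-reflexive (∑-zero n (λ j → cong 𝟙 (≢true⇒≡false (λ gj → Fin-0≢1+n (unique zero (suc j) g0 gj))))))
  ... | false = ∑-𝟙-atMostOne (g ∘ suc) b
                  (λ j j′ gj gj′ → Fin-suc-injective (unique (suc j) (suc j′) gj gj′)) (implies ∘ suc)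

  ∑-𝟙-injection : ∀ {n m} (f : Fin n → Fin m) (P : Fin n → Bool) (R : Fin m → Bool) →
    (∀ j j′ → P j ≡ true → P j′ ≡ true → f j ≡ f j′ → j ≡ j′) →
    (∀ j → P j ≡ true → R (f j) ≡ true) →
    ∑[ j < n ] 𝟙 (P j) ≤ ∑[ p < m ] 𝟙 (R p)
  ∑-𝟙-injection {n} {m} f P R injective maps = begin
    ∑[ j < n ] 𝟙 (P j)                 ≡⟨ sum-cong-≗ split ⟩
    ∑[ j < n ] ∑[ p < m ] 𝟙 (hit j p)  ≡⟨ ∑-comm (λ j p → 𝟙 (hit j p)) ⟩
    ∑[ p < m ] ∑[ j < n ] 𝟙 (hit j p)  ≤⟨ ∑-mono-≤ (λ p → ∑-𝟙-atMostOne (λ j → hit j p) (R p) (unique p) (implies p)) ⟩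
    ∑[ p < m ] 𝟙 (R p)                 ∎
    where
    open ≤-Reasoning
    hit : Fin n → Fin m → Bool
    hit j p = P j ∧ (f j =ꟳ p)
    split : ∀ j → 𝟙 (P j) ≡ ∑[ p < m ] 𝟙 (hit j p)
    split j with P j
    ... | true  = sym (∑-𝟙-=ꟳ (f j))
    ... | false = sym (∑-zero m (λ _ → refl))
    unique : ∀ p j j′ → hit j p ≡ true → hit j′ p ≡ true → j ≡ j′
    unique p j j′ hj hj′ = injective j j′ (∧-trueˡ hj) (∧-trueˡ hj′)
      (trans (=ꟳ⇒≡ (∧-trueʳ {P j} hj)) (sym (=ꟳ⇒≡ (∧-trueʳ {P j′} hj′))))
    implies : ∀ p j → hit j p ≡ true → R p ≡ true
    implies p j hj = subst (λ q → R q ≡ true) (=ꟳ⇒≡ (∧-trueʳ {P j} hj)) (maps j (∧-trueˡ hj))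

  sumMap : ∀ {A : Set} → (A → ℕ) → List A → ℕ
  sumMap F xs = sum (map F xs)

  sumMap-cong : ∀ {A : Set} {F G : A → ℕ} (xs : List A) → (∀ x → F x ≡ G x) → sumMap F xs ≡ sumMap G xs
  sumMap-cong []       h = refl
  sumMap-cong (x ∷ xs) h = cong₂ _+_ (h x) (sumMap-cong xs h)

  sumMap-mono-≤ : ∀ {A : Set} {F G : A → ℕ} (xs : List A) → (∀ x → F x ≤ G x) → sumMap F xs ≤ sumMap G xs
  sumMap-mono-≤ []       h = z≤n
  sumMap-mono-≤ (x ∷ xs) h = +-mono-≤ (h x) (sumMap-mono-≤ xs h)

  sumMap-*ˡ : ∀ {A : Set} c (F : A → ℕ) (xs : List A) → sumMap (λ x → c * F x) xs ≡ c * sumMap F xs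
  sumMap-*ˡ c F []       = sym (*-zeroʳ c)
  sumMap-*ˡ c F (x ∷ xs) = trans (cong (c * F x +_) (sumMap-*ˡ c F xs)) (sym (*-distribˡ-+ c (F x) _))

  sumMap-∑ : ∀ {A : Set} {n} (F : A → Fin n → ℕ) (xs : List A) →
    sumMap (λ x → ∑[ i < n ] F x i) xs ≡ ∑[ i < n ] sumMap (λ x → F x i) xs
  sumMap-∑ {n = n} F []       = sym (trans (∑-const n 0) (*-zeroʳ n))
  sumMap-∑         F (x ∷ xs) = trans (cong (_ +_) (sumMap-∑ F xs)) (sym (∑-distrib-+ (F x) _))

  sumMap-concatMap : ∀ {A B : Set} (F : B → ℕ) (g : A → List B) (xs : List A) →
    sumMap F (concatMap g xs) ≡ sumMap (λ x → sumMap F (g x)) xs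
  sumMap-concatMap F g []       = refl
  sumMap-concatMap F g (x ∷ xs) = begin
    sum (map F (g x ++ concatMap g xs))                ≡⟨ cong sum (map-++ F (g x) (concatMap g xs)) ⟩
    sum (map F (g x) ++ map F (concatMap g xs))        ≡⟨ sum-++ (map F (g x)) _ ⟩
    sumMap F (g x) + sumMap F (concatMap g xs)         ≡⟨ cong (sumMap F (g x) +_) (sumMap-concatMap F g xs) ⟩
    sumMap F (g x) + sumMap (λ y → sumMap F (g y)) xs  ∎
    where open ≡-Reasoning

  sumMap-map : ∀ {A B : Set} (F : B → ℕ) (g : A → B) (xs : List A) → sumMap F (map g xs) ≡ sumMap (F ∘ g) xs
  sumMap-map F g []       = refl
  sumMap-map F g (x ∷ xs) = cong (F (g x) +_) (sumMap-map F g xs)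

  length-filter : ∀ {A : Set} (p : A → Bool) (xs : List A) →
    length (filter (λ x → T? (p x)) xs) ≡ sumMap (𝟙 ∘ p) xs
  length-filter p []       = refl
  length-filter p (x ∷ xs) with p x
  ... | true  = cong suc (length-filter p xs)
  ... | false = length-filter p xs

  sumVecs : ∀ n k → (Vec (Fin n) k → ℕ) → ℕ
  sumVecs n k F = sumMap F (allVecs n k)

  sumVecs-suc : ∀ n k (F : Vec (Fin n) (suc k) → ℕ) →
    sumVecs n (suc k) F ≡ ∑[ x < n ] sumVecs n k (λ v → F (x ∷ v))
  sumVecs-suc n k F = begin
    sumMap F (concatMap (λ x → map (x ∷_) (allVecs n k)) (allFin n))  ≡⟨ sumMap-concatMap F _ (allFin n) ⟩
    sumMap (λ x → sumMap F (map (x ∷_) (allVecs n k))) (allFin n)     ≡⟨ sumMap-cong (allFin n) (λ x → sumMap-map F (x ∷_) (allVecs n k)) ⟩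
    sumMap (λ x → sumVecs n k (λ v → F (x ∷ v))) (allFin n)           ≡⟨ sum-map-allFin n _ ⟩
    ∑[ x < n ] sumVecs n k (λ v → F (x ∷ v))                          ∎
    where open ≡-Reasoning

  e≡sumVecs : ∀ {n} (Q : FinPoset n) → e Q ≡ sumVecs n n (𝟙 ∘ isLinExt Q)
  e≡sumVecs {n} Q = length-filter (isLinExt Q) (allVecs n n)

  ∏-syntax : ∀ k → (Fin k → ℕ) → ℕ
  ∏-syntax zero    f = 1
  ∏-syntax (suc k) f = f zero * ∏-syntax k (f ∘ suc)

  infixl 10 ∏-syntax
  syntax ∏-syntax k (λ i → x) = ∏[ i < k ] x

  ∏-cong : ∀ {k} {f g : Fin k → ℕ} → (∀ i → f i ≡ g i) → ∏[ i < k ] f i ≡ ∏[ i < k ] g i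
  ∏-cong {zero}  h = refl
  ∏-cong {suc k} h = cong₂ _*_ (h zero) (∏-cong (h ∘ suc))

  inBox : ∀ {n k} → (Fin k → Fin n → Bool) → Vec (Fin n) k → Bool
  inBox A []      = true
  inBox A (x ∷ v) = A zero x ∧ inBox (A ∘ suc) v

  inBox⁺ : ∀ {n k} (A : Fin k → Fin n → Bool) (v : Vec (Fin n) k) →
    (∀ i → A i (lookup v i) ≡ true) → inBox A v ≡ true
  inBox⁺ A []      h = refl
  inBox⁺ A (x ∷ v) h = ∧-true (h zero) (inBox⁺ (A ∘ suc) v (h ∘ suc))

  inBox⁻ : ∀ {n k} (A : Fin k → Fin n → Bool) (v : Vec (Fin n) k) →
    inBox A v ≡ true → ∀ i → A i (lookup v i) ≡ true
  inBox⁻ A (x ∷ v) h zero    = ∧-trueˡ h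
  inBox⁻ A (x ∷ v) h (suc i) = inBox⁻ (A ∘ suc) v (∧-trueʳ {A zero x} h) i

  inBox-cong : ∀ {n k} {A B : Fin k → Fin n → Bool} → (∀ i p → A i p ≡ B i p) → ∀ v → inBox A v ≡ inBox B v
  inBox-cong h []      = refl
  inBox-cong h (x ∷ v) = cong₂ _∧_ (h zero x) (inBox-cong (h ∘ suc) v)

  sumVecs-inBox : ∀ n k (A : Fin k → Fin n → Bool) →
    sumVecs n k (𝟙 ∘ inBox A) ≡ ∏[ i < k ] ∑[ p < n ] 𝟙 (A i p)
  sumVecs-inBox n zero    A = refl
  sumVecs-inBox n (suc k) A = begin
    sumVecs n (suc k) (𝟙 ∘ inBox A)                                  ≡⟨ sumVecs-suc n k _ ⟩
    ∑[ x < n ] sumVecs n k (λ v → 𝟙 (A zero x ∧ inBox (A ∘ suc) v))  ≡⟨ sum-cong-≗ factor ⟩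
    ∑[ x < n ] (𝟙 (A zero x) * sumVecs n k (𝟙 ∘ inBox (A ∘ suc)))    ≡⟨ ∑-*ʳ (sumVecs n k (𝟙 ∘ inBox (A ∘ suc))) (λ x → 𝟙 (A zero x)) ⟩
    (∑[ x < n ] 𝟙 (A zero x)) * sumVecs n k (𝟙 ∘ inBox (A ∘ suc))    ≡⟨ cong ((∑[ x < n ] 𝟙 (A zero x)) *_) (sumVecs-inBox n k (A ∘ suc)) ⟩
    ∏[ i < suc k ] ∑[ p < n ] 𝟙 (A i p)                              ∎
    where
    open ≡-Reasoning
    factor : ∀ x → sumVecs n k (λ v → 𝟙 (A zero x ∧ inBox (A ∘ suc) v))
                 ≡ 𝟙 (A zero x) * sumVecs n k (𝟙 ∘ inBox (A ∘ suc))
    factor x = trans (sumMap-cong (allVecs n k) (λ v → 𝟙-∧ (A zero x) _)) (sumMap-*ˡ (𝟙 (A zero x)) (𝟙 ∘ inBox (A ∘ suc)) (allVecs n k))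

module LinearExtensions where

  open import Data.Nat
  open import Data.Nat.Properties
  open import Data.Bool.Base using (Bool; true; false; _∧_; _∨_; not; if_then_else_)
  open import Data.Fin.Base using (Fin; toℕ)
  open import Data.Fin.Properties using (toℕ-injective; toℕ<n)
  open import Data.Vec.Base using (Vec; lookup)
  open import Data.List.Base using (allFin; map)
  open import Data.Nat.ListAction using (sum)
  open import Algebra.Properties.Semiring.Sum +-*-semiring
    using (sum-syntax; sum-cong-≗; ∑-distrib-+; ∑-comm)
  open import Data.Bool.Properties using (∧-zeroʳ)
  open import Data.Empty using (⊥-elim)
  open import Relation.Binary.PropositionalEquality
  open import Function using (_∘_)
  open Booleans
  open Sums

  module _ {n} (Q : FinPoset n) where

    strictlyBelow strictlyAbove : Fin n → Fin n → Bool
    strictlyBelow i j = not (j =ꟳ i) ∧ le Q j i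
    strictlyAbove i j = not (i =ꟳ j) ∧ le Q i j

    below above slack : Fin n → ℕ
    below i = ∑[ j < n ] 𝟙 (strictlyBelow i j)
    above i = ∑[ j < n ] 𝟙 (strictlyAbove i j)
    slack i = n ∸ above i ∸ below i

  module _ {n} (Q : FinPoset n) (σ : Vec (Fin n) n) (lin : isLinExt Q σ ≡ true) where

    private
      position : Fin n → ℕ
      position i = toℕ (lookup σ i)

      condition : ∀ i j →
        ((i =ꟳ j ∨ not (lookup σ i =ꟳ lookup σ j)) ∧ (not (le Q i j) ∨ not (lookup σ j <ꟳ lookup σ i))) ≡ true
      condition i j = allB-tabulate⁻ _ (λ j → j) (allB-tabulate⁻ _ (λ i → i) lin i) j

    linExt-injective : ∀ i j → lookup σ i ≡ lookup σ j → i ≡ j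
    linExt-injective i j eq = =ꟳ⇒≡ (∨-resolveʳ (∧-trueˡ (condition i j)) (cong not (≡⇒=ꟳ eq)))

    linExt-monotone : ∀ i j → le Q i j ≡ true → position i ≤ position j
    linExt-monotone i j i≤j = ≮⇒≥ (λ j<i → true≢false (trans (sym (<⇒<ᵇ′ j<i))
      (not-true (∨-resolveˡ (∧-trueʳ {i =ꟳ j ∨ not (lookup σ i =ꟳ lookup σ j)} (condition i j)) (cong not i≤j)))))

    linExt-strictlyMonotone : ∀ i j → (i =ꟳ j) ≡ false → le Q i j ≡ true → position i < position j
    linExt-strictlyMonotone i j i≢j i≤j = ≤∧≢⇒< (linExt-monotone i j i≤j)
      (λ eq → true≢false (trans (sym (≡⇒=ꟳ (linExt-injective i j (toℕ-injective eq)))) i≢j))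

    below≤position : ∀ i → below Q i ≤ position i
    below≤position i = begin
      below Q i                                         ≤⟨ ∑-𝟙-injection (lookup σ) _ (inRange 0 (position i) ∘ toℕ)
                                                             (λ j j′ _ _ → linExt-injective j j′) lower ⟩
      ∑[ p < n ] 𝟙 (inRange 0 (position i) (toℕ p))     ≡⟨ ∑-inRange n 0 (position i) (<⇒≤ (toℕ<n (lookup σ i))) ⟩
      position i                                        ∎
      where
      open ≤-Reasoning
      lower : ∀ j → strictlyBelow Q i j ≡ true → inRange 0 (position i) (position j) ≡ true
      lower j h = ∧-true refl (<⇒<ᵇ′ (linExt-strictlyMonotone j i (not-true (∧-trueˡ h)) (∧-trueʳ {not (j =ꟳ i)} h)))

    above≤positionsAfter : ∀ i → above Q i ≤ n ∸ suc (position i)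
    above≤positionsAfter i = begin
      above Q i                                              ≤⟨ ∑-𝟙-injection (lookup σ) _ (inRange (suc (position i)) n ∘ toℕ)
                                                                  (λ j j′ _ _ → linExt-injective j j′) upper ⟩
      ∑[ p < n ] 𝟙 (inRange (suc (position i)) n (toℕ p))    ≡⟨ ∑-inRange n (suc (position i)) n ≤-refl ⟩
      n ∸ suc (position i)                                   ∎
      where
      open ≤-Reasoning
      upper : ∀ j → strictlyAbove Q i j ≡ true → inRange (suc (position i)) n (position j) ≡ true
      upper j h = ∧-true (<⇒<ᵇ′ (s≤s (linExt-strictlyMonotone i j (not-true (∧-trueˡ h)) (∧-trueʳ {not (i =ꟳ j)} h))))
                         (<⇒<ᵇ′ (toℕ<n (lookup σ j)))

    position-inRange : ∀ i → inRange (below Q i) (n ∸ above Q i) (position i) ≡ true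
    position-inRange i = ∧-true (<⇒<ᵇ′ (s≤s (below≤position i)))
      (<⇒<ᵇ′ (m+n≤o⇒m≤o∸n (suc (position i)) (subst (_≤ n) (+-comm (above Q i) _)
        (m≤o∸n⇒m+n≤o (above Q i) (toℕ<n (lookup σ i)) (above≤positionsAfter i)))))

  e≤∏slack : ∀ {n} (Q : FinPoset n) → e Q ≤ ∏[ i < n ] slack Q i
  e≤∏slack {n} Q = begin
    e Q                                   ≡⟨ e≡sumVecs Q ⟩
    sumVecs n n (𝟙 ∘ isLinExt Q)          ≤⟨ sumMap-mono-≤ (allVecs n n) linExt⇒inBox ⟩
    sumVecs n n (𝟙 ∘ inBox window)        ≡⟨ sumVecs-inBox n n window ⟩
    ∏[ i < n ] ∑[ p < n ] 𝟙 (window i p)  ≡⟨ ∏-cong (λ i → ∑-inRange n (below Q i) _ (m∸n≤m n (above Q i))) ⟩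
    ∏[ i < n ] slack Q i                  ∎
    where
    open ≤-Reasoning
    window : Fin n → Fin n → Bool
    window i p = inRange (below Q i) (n ∸ above Q i) (toℕ p)
    linExt⇒inBox : ∀ σ → 𝟙 (isLinExt Q σ) ≤ 𝟙 (inBox window σ)
    linExt⇒inBox σ = 𝟙-mono (λ lin → inBox⁺ window σ (position-inRange Q σ lin))

  below+above≤n : ∀ {n} (Q : FinPoset n) i → below Q i + above Q i ≤ n
  below+above≤n {n} Q i = begin
    below Q i + above Q i                                           ≡⟨ ∑-distrib-+ (𝟙 ∘ strictlyBelow Q i) _ ⟨
    ∑[ j < n ] (𝟙 (strictlyBelow Q i j) + 𝟙 (strictlyAbove Q i j))  ≤⟨ ∑-mono-≤ (λ j → notBoth j) ⟩
    ∑[ j < n ] 1                                                    ≡⟨ ∑-const n 1 ⟩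
    n * 1                                                           ≡⟨ *-identityʳ n ⟩
    n                                                               ∎
    where
    open ≤-Reasoning
    exclusive : ∀ a b c d → (c ≡ true → d ≡ true → a ≡ false) → 𝟙 (a ∧ c) + 𝟙 (b ∧ d) ≤ 1
    exclusive true  b true  true  h = ⊥-elim (true≢false (h refl refl))
    exclusive true  b true  false h rewrite ∧-zeroʳ b = s≤s z≤n
    exclusive true  b false d     h = 𝟙≤1 (b ∧ d)
    exclusive false b c     d     h = 𝟙≤1 (b ∧ d)
    notBoth : ∀ j → 𝟙 (strictlyBelow Q i j) + 𝟙 (strictlyAbove Q i j) ≤ 1
    notBoth j = exclusive _ _ _ _ (λ j≤i i≤j → cong not (≡⇒=ꟳ (sym (antisym Q i j i≤j j≤i))))

  ∑slack+∑[below+above] : ∀ {n} (Q : FinPoset n) →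
    ∑[ i < n ] slack Q i + ∑[ i < n ] (below Q i + above Q i) ≡ n * n
  ∑slack+∑[below+above] {n} Q = begin
    ∑[ i < n ] slack Q i + ∑[ i < n ] (below Q i + above Q i)  ≡⟨ ∑-distrib-+ (slack Q) _ ⟨
    ∑[ i < n ] (slack Q i + (below Q i + above Q i))           ≡⟨ sum-cong-≗ complement ⟩
    ∑[ i < n ] n                                               ≡⟨ ∑-const n n ⟩
    n * n                                                      ∎
    where
    open ≡-Reasoning
    complement : ∀ i → slack Q i + (below Q i + above Q i) ≡ n
    complement i = begin
      n ∸ above Q i ∸ below Q i + (below Q i + above Q i)    ≡⟨ cong₂ _+_ (∸-+-assoc n (above Q i) (below Q i)) (+-comm (below Q i) _) ⟩
      n ∸ (above Q i + below Q i) + (above Q i + below Q i)  ≡⟨ m∸n+n≡m (subst (_≤ n) (+-comm (below Q i) _) (below+above≤n Q i)) ⟩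
      n                                                      ∎

  comp≡∑ : ∀ {n} (Q : FinPoset n) →
    comp Q ≡ ∑[ i < n ] ∑[ j < n ] 𝟙 ((i <ꟳ j) ∧ (le Q i j ∨ le Q j i))
  comp≡∑ {n} Q = trans (sum-map-allFin n row) (sum-cong-≗ {n} (λ i → trans (sum-map-allFin n (entry i)) (sum-cong-≗ {n} (λ j → if≡𝟙 _))))
    where
    entry : Fin n → Fin n → ℕ
    entry i j = if (i <ꟳ j) ∧ (le Q i j ∨ le Q j i) then 1 else 0
    row : Fin n → ℕ
    row i = sum (map (entry i) (allFin n))
    if≡𝟙 : ∀ b → (if b then 1 else 0) ≡ 𝟙 b
    if≡𝟙 true  = refl
    if≡𝟙 false = refl

  2*comp≤∑[below+above] : ∀ {n} (Q : FinPoset n) → comp Q + comp Q ≤ ∑[ i < n ] (below Q i + above Q i)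
  2*comp≤∑[below+above] {n} Q = begin
    comp Q + comp Q                                         ≡⟨ cong₂ _+_ (comp≡∑ Q) (trans (comp≡∑ Q) (∑-comm comparable)) ⟩
    ∑[ i < n ] ∑[ j < n ] comparable i j + ∑[ i < n ] ∑[ j < n ] comparable j i
                                                            ≡⟨ ∑-distrib-+ (λ i → ∑[ j < n ] comparable i j) _ ⟨
    ∑[ i < n ] (∑[ j < n ] comparable i j + ∑[ j < n ] comparable j i)
                                                            ≡⟨ sum-cong-≗ (λ i → sym (∑-distrib-+ (comparable i) _)) ⟩
    ∑[ i < n ] ∑[ j < n ] (comparable i j + comparable j i) ≤⟨ ∑-mono-≤ (λ i → ∑-mono-≤ (λ j → orderedPair≤ i j)) ⟩
    ∑[ i < n ] ∑[ j < n ] (𝟙 (strictlyBelow Q i j) + 𝟙 (strictlyAbove Q i j))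
                                                            ≡⟨ sum-cong-≗ (λ i → ∑-distrib-+ (𝟙 ∘ strictlyBelow Q i) _) ⟩
    ∑[ i < n ] (below Q i + above Q i)                      ∎
    where
    open ≤-Reasoning
    comparable : Fin n → Fin n → ℕ
    comparable i j = 𝟙 ((i <ꟳ j) ∧ (le Q i j ∨ le Q j i))
    orderedPair≤ : ∀ i j →
      𝟙 ((i <ꟳ j) ∧ (le Q i j ∨ le Q j i)) + 𝟙 ((j <ꟳ i) ∧ (le Q j i ∨ le Q i j))
        ≤ 𝟙 (not (j =ꟳ i) ∧ le Q j i) + 𝟙 (not (i =ꟳ j) ∧ le Q i j)
    orderedPair≤ i j with i <ꟳ j in i<j | j <ꟳ i in j<i | j =ꟳ i in j=i | i =ꟳ j in i=j
    ... | true  | true  | _     | _     = ⊥-elim (<-asym (<ꟳ⇒< {i = i} {j} i<j) (<ꟳ⇒< {i = j} {i} j<i))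
    ... | true  | false | true  | _     = ⊥-elim (<-irrefl (cong toℕ (sym (=ꟳ⇒≡ {i = j} {i} j=i))) (<ꟳ⇒< {i = i} {j} i<j))
    ... | true  | false | false | true  = ⊥-elim (<-irrefl (cong toℕ (=ꟳ⇒≡ {i = i} {j} i=j)) (<ꟳ⇒< {i = i} {j} i<j))
    ... | true  | false | false | false = ∨≤ (le Q i j) (le Q j i)
      where
      ∨≤ : ∀ a b → 𝟙 (a ∨ b) + 0 ≤ 𝟙 b + 𝟙 a
      ∨≤ true  true  = s≤s z≤n
      ∨≤ true  false = s≤s z≤n
      ∨≤ false b     = ≤-refl
    ... | false | true  | true  | _     = ⊥-elim (<-irrefl (cong toℕ (=ꟳ⇒≡ {i = j} {i} j=i)) (<ꟳ⇒< {i = j} {i} j<i))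
    ... | false | true  | false | true  = ⊥-elim (<-irrefl (cong toℕ (sym (=ꟳ⇒≡ {i = i} {j} i=j))) (<ꟳ⇒< {i = j} {i} j<i))
    ... | false | true  | false | false = ∨≤ (le Q j i) (le Q i j)
      where
      ∨≤ : ∀ a b → 𝟙 (a ∨ b) ≤ 𝟙 a + 𝟙 b
      ∨≤ true  b = s≤s z≤n
      ∨≤ false b = ≤-refl
    ... | false | false | _     | _     = z≤n

module Estimates where

  open import Data.Nat
  open import Data.Nat.Properties
  open import Data.Nat.DivMod
  open import Data.Nat.Tactic.RingSolver using (solve-∀)
  open import Data.Fin.Base using (Fin; zero; suc)
  open import Algebra.Properties.Semiring.Sum +-*-semiring using (sum-syntax)
  open import Relation.Binary.PropositionalEquality
  open import Function using (_∘_)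
  open Sums using (∏-syntax)

  ^-distribʳ-* : ∀ a b m → (a * b) ^ m ≡ a ^ m * b ^ m
  ^-distribʳ-* a b zero    = refl
  ^-distribʳ-* a b (suc m) = trans (cong (a * b *_) (^-distribʳ-* a b m)) (interchange a b (a ^ m) (b ^ m))
    where
    interchange : ∀ p q r s → p * q * (r * s) ≡ p * r * (q * s)
    interchange = solve-∀

  1+n≤2^n : ∀ n → suc n ≤ 2 ^ n
  1+n≤2^n zero    = s≤s z≤n
  1+n≤2^n (suc n) = begin
    suc (suc n)    ≤⟨ +-mono-≤ (1≤2^n n) (1+n≤2^n n) ⟩
    2 ^ n + 2 ^ n  ≡⟨ cong (2 ^ n +_) (+-identityʳ (2 ^ n)) ⟨
    2 ^ suc n      ∎
    where
    open ≤-Reasoning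
    1≤2^n : ∀ n → 1 ≤ 2 ^ n
    1≤2^n n = m^n>0 2 n

  m≤2^[m/a]*a : ∀ m a .{{_ : NonZero a}} → m ≤ 2 ^ (m / a) * a
  m≤2^[m/a]*a m a = begin
    m                    ≡⟨ m≡m%n+[m/n]*n m a ⟩
    m % a + (m / a) * a  ≤⟨ +-monoˡ-≤ ((m / a) * a) (<⇒≤ (m%n<n m a)) ⟩
    suc (m / a) * a      ≤⟨ *-monoˡ-≤ a (1+n≤2^n (m / a)) ⟩
    2 ^ (m / a) * a      ∎
    where open ≤-Reasoning

  ∏≤^*2^∑/ : ∀ {n} (x : Fin n → ℕ) a .{{_ : NonZero a}} → ∏[ i < n ] x i ≤ a ^ n * 2 ^ (∑[ i < n ] (x i / a))
  ∏≤^*2^∑/ {zero}  x a = ≤-refl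
  ∏≤^*2^∑/ {suc n} x a = begin
    x zero * ∏[ i < n ] x (suc i)                ≤⟨ *-mono-≤ (m≤2^[m/a]*a (x zero) a) (∏≤^*2^∑/ (x ∘ suc) a) ⟩
    (2 ^ (x zero / a) * a) * (a ^ n * 2 ^ rest)  ≡⟨ interchange (2 ^ (x zero / a)) a (a ^ n) (2 ^ rest) ⟩
    (a * a ^ n) * (2 ^ (x zero / a) * 2 ^ rest)  ≡⟨ cong (a * a ^ n *_) (^-distribˡ-+-* 2 (x zero / a) rest) ⟨
    a ^ suc n * 2 ^ (∑[ i < suc n ] (x i / a))   ∎
    where
    open ≤-Reasoning
    rest = ∑[ i < n ] (x (suc i) / a)
    interchange : ∀ p q r s → (p * q) * (r * s) ≡ (q * r) * (p * s)
    interchange = solve-∀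

  [1+j+c]^j*c≤[j+c]^[1+j] : ∀ j c → suc (j + c) ^ j * c ≤ (j + c) ^ suc j
  [1+j+c]^j*c≤[j+c]^[1+j] zero    c = ≤-reflexive (trans (+-identityʳ c) (sym (*-identityʳ c)))
  [1+j+c]^j*c≤[j+c]^[1+j] (suc j) c = begin
    suc N ^ suc j * c                  ≡⟨ rearrange₁ (suc N) (suc N ^ j) c ⟩
    suc N ^ j * (suc N * c)            ≤⟨ *-monoʳ-≤ (suc N ^ j) step ⟩
    suc N ^ j * (N * suc c)            ≡⟨ rearrange₂ (suc N ^ j) N (suc c) ⟩
    N * (suc N ^ j * suc c)            ≡⟨ cong (λ z → N * (suc z ^ j * suc c)) (+-suc j c) ⟨
    N * (suc (j + suc c) ^ j * suc c)  ≤⟨ *-monoʳ-≤ N ([1+j+c]^j*c≤[j+c]^[1+j] j (suc c)) ⟩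
    N * (j + suc c) ^ suc j            ≡⟨ cong (λ z → N * z ^ suc j) (+-suc j c) ⟩
    N ^ suc (suc j)                    ∎
    where
    open ≤-Reasoning
    N = suc j + c
    rearrange₁ : ∀ x y z → x * y * z ≡ y * (x * z)
    rearrange₁ = solve-∀
    rearrange₂ : ∀ x y z → x * (y * z) ≡ y * (x * z)
    rearrange₂ = solve-∀
    step : suc N * c ≤ N * suc c
    step = begin
      c + N * c  ≤⟨ +-monoˡ-≤ (N * c) (m≤n+m c (suc j)) ⟩
      N + N * c  ≡⟨ *-suc N c ⟨
      N * suc c  ∎

  [1+2m]^m≤2*[2m]^m : ∀ m → suc (m + m) ^ m ≤ 2 * (m + m) ^ m
  [1+2m]^m≤2*[2m]^m zero       = s≤s z≤n
  [1+2m]^m≤2*[2m]^m m@(suc _)  = *-cancelʳ-≤ _ _ m (begin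
    suc (m + m) ^ m * m  ≤⟨ [1+j+c]^j*c≤[j+c]^[1+j] m m ⟩
    (m + m) ^ suc m      ≡⟨ rearrange ((m + m) ^ m) m ⟩
    2 * (m + m) ^ m * m  ∎)
    where
    open ≤-Reasoning
    rearrange : ∀ y m → (m + m) * y ≡ 2 * y * m
    rearrange = solve-∀

  [1+m]^m≤4*m^m : ∀ m → suc m ^ m ≤ 4 * m ^ m
  [1+m]^m≤4*m^m zero      = s≤s z≤n
  [1+m]^m≤4*m^m m@(suc k) = *-cancelʳ-≤ _ _ (T ^ m * T ^ m) {{T^m*T^m≢0}} (begin
    suc m ^ m * (T ^ m * T ^ m)        ≡⟨ cong (suc m ^ m *_) (^-distribʳ-* T T m) ⟨
    suc m ^ m * (T * T) ^ m            ≡⟨ ^-distribʳ-* (suc m) (T * T) m ⟨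
    (suc m * (T * T)) ^ m              ≤⟨ ^-monoˡ-≤ m square ⟩
    (m * (suc T * suc T)) ^ m          ≡⟨ trans (^-distribʳ-* m (suc T * suc T) m) (cong (m ^ m *_) (^-distribʳ-* (suc T) (suc T) m)) ⟩
    m ^ m * (suc T ^ m * suc T ^ m)    ≤⟨ *-monoʳ-≤ (m ^ m) (*-mono-≤ ([1+2m]^m≤2*[2m]^m m) ([1+2m]^m≤2*[2m]^m m)) ⟩
    m ^ m * (2 * T ^ m * (2 * T ^ m))  ≡⟨ rearrange (m ^ m) (T ^ m) ⟩
    4 * m ^ m * (T ^ m * T ^ m)        ∎)
    where
    open ≤-Reasoning
    T = m + m
    T^m*T^m≢0 : NonZero (T ^ m * T ^ m)
    T^m*T^m≢0 = >-nonZero (*-mono-< (m^n>0 T m) (m^n>0 T m))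
    rearrange : ∀ x y → x * (2 * y * (2 * y)) ≡ 4 * x * (y * y)
    rearrange = solve-∀
    identity : ∀ k → suc (suc k) * ((suc k + suc k) * (suc k + suc k)) + suc k
                   ≡ suc k * (suc (suc k + suc k) * suc (suc k + suc k))
    identity = solve-∀
    square : suc m * (T * T) ≤ m * (suc T * suc T)
    square = subst (suc m * (T * T) ≤_) (identity k) (m≤m+n _ _)

  n!≤n^n : ∀ n → n ! ≤ n ^ n
  n!≤n^n zero    = s≤s z≤n
  n!≤n^n (suc n) = *-monoʳ-≤ (suc n) (≤-trans (n!≤n^n n) (^-monoˡ-≤ n (n≤1+n n)))

  m^m≤4^m*m! : ∀ m → m ^ m ≤ 4 ^ m * m !
  m^m≤4^m*m! zero    = s≤s z≤n
  m^m≤4^m*m! (suc m) = begin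
    suc m * suc m ^ m            ≤⟨ *-monoʳ-≤ (suc m) ([1+m]^m≤4*m^m m) ⟩
    suc m * (4 * m ^ m)          ≤⟨ *-monoʳ-≤ (suc m) (*-monoʳ-≤ 4 (m^m≤4^m*m! m)) ⟩
    suc m * (4 * (4 ^ m * m !))  ≡⟨ rearrange (suc m) (4 ^ m) (m !) ⟩
    4 * 4 ^ m * (suc m * m !)    ∎
    where
    open ≤-Reasoning
    rearrange : ∀ a b c → a * (4 * (b * c)) ≡ 4 * b * (a * c)
    rearrange = solve-∀

  k^s≤2^k*s^s : ∀ k s → k ^ s ≤ 2 ^ k * s ^ s
  k^s≤2^k*s^s k zero       = subst (1 ≤_) (sym (*-identityʳ (2 ^ k))) (m^n>0 2 k)
  k^s≤2^k*s^s k s@(suc _)  = begin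
    k ^ s                      ≤⟨ ^-monoˡ-≤ s (m≤2^[m/a]*a k s) ⟩
    (2 ^ (k / s) * s) ^ s      ≡⟨ ^-distribʳ-* (2 ^ (k / s)) s s ⟩
    (2 ^ (k / s)) ^ s * s ^ s  ≡⟨ cong (_* s ^ s) (^-*-assoc 2 (k / s) s) ⟩
    2 ^ (k / s * s) * s ^ s    ≤⟨ *-monoˡ-≤ (s ^ s) (^-monoʳ-≤ 2 (m/n*n≤m k s)) ⟩
    2 ^ k * s ^ s              ∎
    where open ≤-Reasoning

  ∏ℕ : ℕ → (ℕ → ℕ) → ℕ
  ∏ℕ zero    g = 1
  ∏ℕ (suc n) g = g 0 * ∏ℕ n (g ∘ suc)

  ∏ℕ-cong : ∀ n {f g : ℕ → ℕ} → (∀ i → i < n → f i ≡ g i) → ∏ℕ n f ≡ ∏ℕ n g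
  ∏ℕ-cong zero    h = refl
  ∏ℕ-cong (suc n) h = cong₂ _*_ (h 0 z<s) (∏ℕ-cong n (λ i i<n → h (suc i) (s<s i<n)))

  ∏ℕ-+ : ∀ a b g → ∏ℕ (a + b) g ≡ ∏ℕ a g * ∏ℕ b (λ i → g (a + i))
  ∏ℕ-+ zero    b g = sym (+-identityʳ _)
  ∏ℕ-+ (suc a) b g = trans (cong (g 0 *_) (∏ℕ-+ a b (g ∘ suc))) (sym (*-assoc (g 0) _ _))

  ∏ℕ[1+c+i]*c!≡[c+s]! : ∀ s c → ∏ℕ s (λ i → suc (c + i)) * c ! ≡ (c + s) !
  ∏ℕ[1+c+i]*c!≡[c+s]! zero    c = trans (+-identityʳ (c !)) (cong _! (sym (+-identityʳ c)))
  ∏ℕ[1+c+i]*c!≡[c+s]! (suc s) c = begin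
    suc (c + 0) * ∏ℕ s (λ i → suc (c + suc i)) * c !   ≡⟨ cong₂ (λ a b → suc a * b * c !) (+-identityʳ c)
                                                             (∏ℕ-cong s (λ i _ → cong suc (+-suc c i))) ⟩
    suc c * ∏ℕ s (λ i → suc (suc c + i)) * c !         ≡⟨ rearrange (suc c) (∏ℕ s (λ i → suc (suc c + i))) (c !) ⟩
    ∏ℕ s (λ i → suc (suc c + i)) * suc c !             ≡⟨ ∏ℕ[1+c+i]*c!≡[c+s]! s (suc c) ⟩
    (suc c + s) !                                      ≡⟨ cong _! (+-suc c s) ⟨
    (c + suc s) !                                      ∎
    where
    open ≡-Reasoning
    rearrange : ∀ a b c → a * b * c ≡ b * (a * c)
    rearrange = solve-∀

  module _ (k : ℕ) .{{_ : NonZero k}} where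

    ∏ℕ[1+i%k]≡s! : ∀ s → s ≤ k → ∏ℕ s (λ i → suc (i % k)) ≡ s !
    ∏ℕ[1+i%k]≡s! s s≤k = trans (sym (*-identityʳ _))
      (trans (cong (_* 1) (∏ℕ-cong s (λ i i<s → cong suc (m<n⇒m%n≡m (≤-trans i<s s≤k))))) (∏ℕ[1+c+i]*c!≡[c+s]! s 0))

    ∏ℕ[1+i%k]≡[k!]^q*s! : ∀ q s → s ≤ k → ∏ℕ (q * k + s) (λ i → suc (i % k)) ≡ (k !) ^ q * s !
    ∏ℕ[1+i%k]≡[k!]^q*s! zero    s s≤k = trans (∏ℕ[1+i%k]≡s! s s≤k) (sym (+-identityʳ (s !)))
    ∏ℕ[1+i%k]≡[k!]^q*s! (suc q) s s≤k = begin
      ∏ℕ (k + q * k + s) g                 ≡⟨ cong (λ m → ∏ℕ m g) (+-assoc k (q * k) s) ⟩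
      ∏ℕ (k + (q * k + s)) g               ≡⟨ ∏ℕ-+ k (q * k + s) g ⟩
      ∏ℕ k g * ∏ℕ (q * k + s) (λ i → g (k + i))
                                           ≡⟨ cong₂ _*_ (∏ℕ[1+i%k]≡s! k ≤-refl) (∏ℕ-cong (q * k + s) (λ i _ → periodic i)) ⟩
      k ! * ∏ℕ (q * k + s) g               ≡⟨ cong (k ! *_) (∏ℕ[1+i%k]≡[k!]^q*s! q s s≤k) ⟩
      k ! * ((k !) ^ q * s !)              ≡⟨ *-assoc (k !) _ _ ⟨
      (k !) ^ suc q * s !                  ∎
      where
      open ≡-Reasoning
      g : ℕ → ℕ
      g i = suc (i % k)
      periodic : ∀ i → g (k + i) ≡ g i
      periodic i = cong suc (trans (cong (_% k) (+-comm k i)) ([m+n]%n≡m%n i k))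

    k^n≤8^n*∏ℕ[1+i%k] : ∀ n → k ≤ n → k ^ n ≤ 8 ^ n * ∏ℕ n (λ i → suc (i % k))
    k^n≤8^n*∏ℕ[1+i%k] n k≤n = subst (λ m → k ^ m ≤ 8 ^ m * ∏ℕ m (λ i → suc (i % k))) (sym n≡qk+s) (begin
      k ^ (q * k + s)                              ≡⟨ ^-distribˡ-+-* k (q * k) s ⟩
      k ^ (q * k) * k ^ s                          ≡⟨ cong (λ m → k ^ m * k ^ s) (*-comm q k) ⟩
      k ^ (k * q) * k ^ s                          ≡⟨ cong (_* k ^ s) (^-*-assoc k k q) ⟨
      (k ^ k) ^ q * k ^ s                          ≤⟨ *-mono-≤ (^-monoˡ-≤ q (m^m≤4^m*m! k))
                                                               (≤-trans (k^s≤2^k*s^s k s) (*-monoʳ-≤ (2 ^ k) (m^m≤4^m*m! s))) ⟩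
      (4 ^ k * k !) ^ q * (2 ^ k * (4 ^ s * s !))  ≡⟨ cong (_* (2 ^ k * (4 ^ s * s !))) (trans (^-distribʳ-* (4 ^ k) (k !) q) (cong (_* (k !) ^ q) (^-*-assoc 4 k q))) ⟩
      4 ^ (k * q) * (k !) ^ q * (2 ^ k * (4 ^ s * s !))
                                                   ≤⟨ *-monoʳ-≤ (4 ^ (k * q) * (k !) ^ q) (*-mono-≤ (^-monoʳ-≤ 2 k≤kq) (*-monoˡ-≤ (s !) (^-monoˡ-≤ s 4≤8))) ⟩
      4 ^ (k * q) * (k !) ^ q * (2 ^ (k * q) * (8 ^ s * s !))
                                                   ≡⟨ rearrange (4 ^ (k * q)) ((k !) ^ q) (2 ^ (k * q)) (8 ^ s) (s !) ⟩
      (4 ^ (k * q) * 2 ^ (k * q)) * 8 ^ s * ((k !) ^ q * s !)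
                                                   ≡⟨ cong₂ (λ a b → a * 8 ^ s * b) (^-distribʳ-* 4 2 (k * q)) (∏ℕ[1+i%k]≡[k!]^q*s! q s (<⇒≤ (m%n<n n k))) ⟨
      8 ^ (k * q) * 8 ^ s * ∏ℕ (q * k + s) (λ i → suc (i % k))
                                                   ≡⟨ cong (λ m → 8 ^ m * 8 ^ s * ∏ℕ (q * k + s) (λ i → suc (i % k))) (*-comm k q) ⟩
      8 ^ (q * k) * 8 ^ s * ∏ℕ (q * k + s) (λ i → suc (i % k))
                                                   ≡⟨ cong (_* ∏ℕ (q * k + s) (λ i → suc (i % k))) (^-distribˡ-+-* 8 (q * k) s) ⟨
      8 ^ (q * k + s) * ∏ℕ (q * k + s) (λ i → suc (i % k))  ∎)
      where
      open ≤-Reasoning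
      q = n / k
      s = n % k
      n≡qk+s : n ≡ q * k + s
      n≡qk+s = trans (m≡m%n+[m/n]*n n k) (+-comm s (q * k))
      k≤kq : k ≤ k * q
      k≤kq = subst (_≤ k * q) (*-identityʳ k) (*-monoʳ-≤ k (m≥n⇒m/n>0 k≤n))
      4≤8 : 4 ≤ 8
      4≤8 = s≤s (s≤s (s≤s (s≤s z≤n)))
      rearrange : ∀ a x b c y → (a * x) * (b * (c * y)) ≡ (a * b) * c * (x * y)
      rearrange = solve-∀

module UpperBound where

  open import Data.Nat
  open import Data.Nat.Properties
  open import Data.Nat.DivMod
  open import Data.Product using (Σ; _×_; _,_)
  open import Algebra.Properties.Semiring.Sum +-*-semiring using (sum-syntax)
  open import Relation.Binary.PropositionalEquality
  open Sums using (∏-syntax; ∑-mono-≤; ∑-*ʳ)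
  open LinearExtensions
  open Estimates

  e≤[2a]^n : ∀ {n} (Q : FinPoset n) a .{{_ : NonZero a}} → ∑[ i < n ] slack Q i < n * a → e Q ≤ (2 * a) ^ n
  e≤[2a]^n {n} Q a ∑slack<na = begin
    e Q                                       ≤⟨ e≤∏slack Q ⟩
    ∏[ i < n ] slack Q i                      ≤⟨ ∏≤^*2^∑/ (slack Q) a ⟩
    a ^ n * 2 ^ (∑[ i < n ] (slack Q i / a))  ≤⟨ *-monoʳ-≤ (a ^ n) (^-monoʳ-≤ 2 (<⇒≤ ∑quotients<n)) ⟩
    a ^ n * 2 ^ n                             ≡⟨ trans (^-distribʳ-* 2 a n) (*-comm (2 ^ n) (a ^ n)) ⟨
    (2 * a) ^ n                               ∎
    where
    open ≤-Reasoning
    ∑quotients<n : ∑[ i < n ] (slack Q i / a) < n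
    ∑quotients<n = *-cancelʳ-< a _ n (begin-strict
      (∑[ i < n ] (slack Q i / a)) * a  ≡⟨ ∑-*ʳ a (λ i → slack Q i / a) ⟨
      ∑[ i < n ] (slack Q i / a * a)    ≤⟨ ∑-mono-≤ (λ i → m/n*n≤m (slack Q i) a) ⟩
      ∑[ i < n ] slack Q i              <⟨ ∑slack<na ⟩
      n * a                             ∎)

  linExt-upperBound : ∀ {m} (Q : FinPoset (suc m)) → let n = suc m in
    Σ ℕ λ a → e Q ≤ (2 * a) ^ n × a * n + (comp Q + comp Q) ≤ n * n + n
  linExt-upperBound {m} Q = a , e≤[2a]^n Q a ∑slack<na , an+2comp≤n²+n
    where
    n = suc m
    S = ∑[ i < n ] slack Q i
    a = suc (S / n)
    ∑slack<na : S < n * a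
    ∑slack<na = begin-strict
      S                  ≡⟨ m≡m%n+[m/n]*n S n ⟩
      S % n + S / n * n  <⟨ +-monoˡ-< (S / n * n) (m%n<n S n) ⟩
      a * n              ≡⟨ *-comm a n ⟩
      n * a              ∎
      where open ≤-Reasoning
    an+2comp≤n²+n : a * n + (comp Q + comp Q) ≤ n * n + n
    an+2comp≤n²+n = begin
      a * n + (comp Q + comp Q)                     ≤⟨ +-mono-≤ (+-monoʳ-≤ n (m/n*n≤m S n)) (2*comp≤∑[below+above] Q) ⟩
      (n + S) + ∑[ i < n ] (below Q i + above Q i)  ≡⟨ +-assoc n S _ ⟩
      n + (S + ∑[ i < n ] (below Q i + above Q i))  ≡⟨ cong (n +_) (∑slack+∑[below+above] Q) ⟩
      n + n * n                                     ≡⟨ +-comm n (n * n) ⟩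
      n * n + n                                     ∎
      where open ≤-Reasoning

module DistinctVectors where

  open import Data.Nat
  open import Data.Nat.Properties
  open import Data.Bool.Base using (Bool; true; false; _∧_; _∨_; not)
  open import Data.Bool.Properties using (∧-zeroʳ)
  open import Data.Fin.Base using (Fin; zero; suc)
  open import Data.Vec.Base using (Vec; []; _∷_; lookup)
  open import Algebra.Properties.Semiring.Sum +-*-semiring using (sum-syntax; sum-cong-≗; ∑-distrib-+)
  open import Data.Empty using (⊥-elim)
  open import Relation.Binary.PropositionalEquality
  open import Function using (_∘_)
  open Booleans
  open Sums

  _∈ᵇ_ : ∀ {n k} → Fin n → Vec (Fin n) k → Bool
  x ∈ᵇ []      = false
  x ∈ᵇ (y ∷ v) = (x =ꟳ y) ∨ (x ∈ᵇ v)

  distinct : ∀ {n k} → Vec (Fin n) k → Bool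
  distinct []      = true
  distinct (x ∷ v) = not (x ∈ᵇ v) ∧ distinct v

  lookup-∈ᵇ : ∀ {n k} (v : Vec (Fin n) k) j → (lookup v j ∈ᵇ v) ≡ true
  lookup-∈ᵇ (y ∷ v) zero    = ∨-trueˡ (≡⇒=ꟳ {i = y} refl)
  lookup-∈ᵇ (y ∷ v) (suc j) = ∨-trueʳ {lookup v j =ꟳ y} (lookup-∈ᵇ v j)

  distinct⇒lookup-injective : ∀ {n k} (v : Vec (Fin n) k) → distinct v ≡ true →
    ∀ i j → lookup v i ≡ lookup v j → i ≡ j
  distinct⇒lookup-injective (x ∷ v) h zero    zero    eq = refl
  distinct⇒lookup-injective (x ∷ v) h zero    (suc j) eq =
    ⊥-elim (true≢false (trans (sym (subst (λ y → (y ∈ᵇ v) ≡ true) (sym eq) (lookup-∈ᵇ v j))) (not-true (∧-trueˡ h))))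
  distinct⇒lookup-injective (x ∷ v) h (suc i) zero    eq =
    ⊥-elim (true≢false (trans (sym (subst (λ y → (y ∈ᵇ v) ≡ true) eq (lookup-∈ᵇ v i))) (not-true (∧-trueˡ h))))
  distinct⇒lookup-injective (x ∷ v) h (suc i) (suc j) eq =
    cong suc (distinct⇒lookup-injective v (∧-trueʳ {not (x ∈ᵇ v)} h) i j eq)

  ∑-𝟙-∈ᵇ≤ : ∀ {n m} (β : Fin n → Bool) (v : Vec (Fin n) m) →
    ∑[ x < n ] 𝟙 (β x ∧ (x ∈ᵇ v)) ≤ ∑[ j < m ] 𝟙 (β (lookup v j))
  ∑-𝟙-∈ᵇ≤ {n} β []      = ≤-reflexive (∑-zero n (λ x → cong 𝟙 (∧-zeroʳ (β x))))
  ∑-𝟙-∈ᵇ≤ {n} β (y ∷ v) = begin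
    ∑[ x < n ] 𝟙 (β x ∧ ((x =ꟳ y) ∨ (x ∈ᵇ v)))                     ≤⟨ ∑-mono-≤ (λ x → 𝟙-∧-∨ (β x) (x =ꟳ y) (x ∈ᵇ v)) ⟩
    ∑[ x < n ] (𝟙 (β x ∧ (x =ꟳ y)) + 𝟙 (β x ∧ (x ∈ᵇ v)))           ≡⟨ ∑-distrib-+ (λ x → 𝟙 (β x ∧ (x =ꟳ y))) _ ⟩
    ∑[ x < n ] 𝟙 (β x ∧ (x =ꟳ y)) + ∑[ x < n ] 𝟙 (β x ∧ (x ∈ᵇ v))  ≤⟨ +-mono-≤ atY (∑-𝟙-∈ᵇ≤ β v) ⟩
    𝟙 (β y) + ∑[ j < _ ] 𝟙 (β (lookup v j))                        ∎
    where
    open ≤-Reasoning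
    𝟙-∧-∨ : ∀ a b c → 𝟙 (a ∧ (b ∨ c)) ≤ 𝟙 (a ∧ b) + 𝟙 (a ∧ c)
    𝟙-∧-∨ false b     c = z≤n
    𝟙-∧-∨ true  true  c = s≤s z≤n
    𝟙-∧-∨ true  false c = ≤-refl
    atY : ∑[ x < n ] 𝟙 (β x ∧ (x =ꟳ y)) ≤ 𝟙 (β y)
    atY = ∑-𝟙-atMostOne _ (β y)
      (λ j j′ hj hj′ → trans (=ꟳ⇒≡ (∧-trueʳ {β j} hj)) (sym (=ꟳ⇒≡ (∧-trueʳ {β j′} hj′))))
      (λ j hj → subst (λ z → β z ≡ true) (=ꟳ⇒≡ (∧-trueʳ {β j} hj)) (∧-trueˡ hj))

  𝟙-∧-not+𝟙-∧ : ∀ a b → 𝟙 (a ∧ not b) + 𝟙 (a ∧ b) ≡ 𝟙 a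
  𝟙-∧-not+𝟙-∧ false b     = refl
  𝟙-∧-not+𝟙-∧ true  true  = refl
  𝟙-∧-not+𝟙-∧ true  false = refl

  countDistinctInBox : ∀ n k → (Fin k → Fin n → Bool) → ℕ
  countDistinctInBox n k A = sumVecs n k (λ v → 𝟙 (distinct v ∧ inBox A v))

  countDistinctInBox-step : ∀ n m (A : Fin (suc m) → Fin n → Bool) c →
    (∀ v → inBox (A ∘ suc) v ≡ true → c ≤ ∑[ x < n ] 𝟙 (A zero x ∧ not (x ∈ᵇ v))) →
    c * countDistinctInBox n m (A ∘ suc) ≤ countDistinctInBox n (suc m) A
  countDistinctInBox-step n m A c enoughChoices = begin
    c * sumVecs n m G                                                 ≡⟨ sumMap-*ˡ c G (allVecs n m) ⟨
    sumVecs n m (λ v → c * G v)                                       ≤⟨ sumMap-mono-≤ (allVecs n m) bound ⟩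
    sumVecs n m (λ v → choices v * G v)                               ≡⟨ sumMap-cong (allVecs n m) (λ v → ∑-*ʳ (G v) (λ x → free x v)) ⟨
    sumVecs n m (λ v → ∑[ x < n ] (free x v * G v))                  ≡⟨ sumMap-∑ (λ v x → free x v * G v) (allVecs n m) ⟩
    ∑[ x < n ] sumVecs n m (λ v → free x v * G v)                    ≡⟨ sum-cong-≗ {n} (λ x → sumMap-cong (allVecs n m) (λ v → extend x v)) ⟩
    ∑[ x < n ] sumVecs n m (λ v → 𝟙 (distinct (x ∷ v) ∧ inBox A (x ∷ v)))
                                                                      ≡⟨ sumVecs-suc n m _ ⟨
    countDistinctInBox n (suc m) A                                    ∎
    where
    open ≤-Reasoning
    G : Vec (Fin n) m → ℕ
    G v = 𝟙 (distinct v ∧ inBox (A ∘ suc) v)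
    free : Fin n → Vec (Fin n) m → ℕ
    free x v = 𝟙 (A zero x ∧ not (x ∈ᵇ v))
    choices : Vec (Fin n) m → ℕ
    choices v = ∑[ x < n ] free x v
    bound : ∀ v → c * G v ≤ choices v * G v
    bound v with distinct v | inBox (A ∘ suc) v in inside
    ... | false | _     = ≤-reflexive (trans (*-zeroʳ c) (sym (*-zeroʳ (choices v))))
    ... | true  | false = ≤-reflexive (trans (*-zeroʳ c) (sym (*-zeroʳ (choices v))))
    ... | true  | true  = *-monoˡ-≤ 1 (enoughChoices v inside)
    𝟙-rearrange : ∀ a b d i → 𝟙 (a ∧ not b) * 𝟙 (i ∧ d) ≡ 𝟙 ((not b ∧ i) ∧ (a ∧ d))
    𝟙-rearrange false b     d i    = sym (cong 𝟙 (∧-zeroʳ (not b ∧ i)))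
    𝟙-rearrange true  true  d i    = refl
    𝟙-rearrange true  false d true = +-identityʳ (𝟙 d)
    𝟙-rearrange true  false d false = refl
    extend : ∀ x v → free x v * G v ≡ 𝟙 (distinct (x ∷ v) ∧ inBox A (x ∷ v))
    extend x v = 𝟙-rearrange (A zero x) (x ∈ᵇ v) (inBox (A ∘ suc) v) (distinct v)

module BlockOrder (k : ℕ) .{{_ : NonZero k}} (n : ℕ) where

  open import Data.Nat
  open import Data.Nat.Properties
  open import Data.Nat.DivMod
  open import Data.Nat.Combinatorics using (_C_)
  open import Data.Bool.Base using (Bool; true; false; _∧_; _∨_; not)
  open import Data.Bool.Properties using (∨-zeroʳ)
  open import Data.Fin.Base using (Fin; toℕ; zero; suc)
  open import Data.Vec.Base using (Vec; lookup)
  open import Data.Sum using (_⊎_; inj₁; inj₂)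
  open import Algebra.Properties.Semiring.Sum +-*-semiring using (sum-syntax; sum-cong-≗; ∑-distrib-+)
  open import Data.Empty using (⊥-elim)
  open import Relation.Binary.PropositionalEquality
  open import Function using (_∘_)
  open Booleans
  open Sums
  open LinearExtensions using (comp≡∑)
  open Estimates using (∏ℕ; ∏ℕ-cong; k^n≤8^n*∏ℕ[1+i%k])
  open DistinctVectors

  sameBlock : ℕ → ℕ → Bool
  sameBlock p s = (p / k) ≡ᵇ (s / k)

  blockBox : ℕ → ∀ {m} → Fin m → Fin n → Bool
  blockBox s i p = sameBlock (toℕ p) (toℕ i + s)

  1+s%k≤∑ℕ-sameBlock : ∀ s → suc (s % k) ≤ ∑ℕ (suc s) (λ p → 𝟙 (sameBlock p s))
  1+s%k≤∑ℕ-sameBlock s = begin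
    suc r                                             ≡⟨ trans (+-∸-assoc 1 (m∸n≤m s r)) (cong suc (m∸[m∸n]≡n (m%n≤m s k))) ⟨
    suc s ∸ (s ∸ r)                                   ≡⟨ ∑ℕ-inRange (suc s) (s ∸ r) (suc s) ≤-refl ⟨
    ∑ℕ (suc s) (λ p → 𝟙 (inRange (s ∸ r) (suc s) p))  ≤⟨ ∑ℕ-mono-≤ (suc s) (λ p _ → 𝟙-mono (inBlock p)) ⟩
    ∑ℕ (suc s) (λ p → 𝟙 (sameBlock p s))              ∎
    where
    open ≤-Reasoning
    r = s % k
    blockStart : s ∸ r ≡ s / k * k
    blockStart = trans (cong (s ∸_) (m%n≡m∸m/n*n s k)) (m∸[m∸n]≡n (m/n*n≤m s k))
    inBlock : ∀ p → inRange (s ∸ r) (suc s) p ≡ true → sameBlock p s ≡ true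
    inBlock p h = T⇒≡true (≡⇒≡ᵇ (p / k) (s / k) (≤-antisym
      (/-monoˡ-≤ k (≤-pred (<ᵇ⇒<′ (∧-trueʳ {s ∸ r <ᵇ suc p} h))))
      (subst (_≤ p / k) (m*n/n≡m (s / k) k) (/-monoˡ-≤ k (subst (_≤ p) blockStart (≤-pred (<ᵇ⇒<′ (∧-trueˡ h))))))))

  1+s%k≤choices : ∀ s m → suc s + m ≤ n → ∀ (v : Vec (Fin n) m) → inBox (blockBox s {suc m} ∘ suc) v ≡ true →
    suc (s % k) ≤ ∑[ x < n ] 𝟙 (blockBox s {suc m} zero x ∧ not (x ∈ᵇ v))
  1+s%k≤choices s m s+m<n v inside = +-cancelʳ-≤ taken (suc (s % k)) free (begin
    suc (s % k) + taken                                                   ≤⟨ +-monoˡ-≤ taken (1+s%k≤∑ℕ-sameBlock s) ⟩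
    ∑ℕ (suc s) β + taken                                                  ≡⟨ cong (∑ℕ (suc s) β +_) (∑ℕ-cong m (λ j _ → cong (β ∘ suc) (+-comm j s))) ⟩
    ∑ℕ (suc s) β + ∑ℕ m (λ j → β (suc s + j))                             ≡⟨ ∑ℕ-+ (suc s) m β ⟨
    ∑ℕ (suc s + m) β                                                      ≤⟨ ∑ℕ-monoˡ-≤ β s+m<n ⟩
    ∑ℕ n β                                                                ≡⟨ ∑-toℕ n β ⟨
    ∑[ x < n ] β (toℕ x)                                                  ≡⟨ sum-cong-≗ {n} (λ x → 𝟙-∧-not+𝟙-∧ (inBlock x) (x ∈ᵇ v)) ⟨
    ∑[ x < n ] (𝟙 (inBlock x ∧ not (x ∈ᵇ v)) + 𝟙 (inBlock x ∧ (x ∈ᵇ v)))  ≡⟨ ∑-distrib-+ (λ x → 𝟙 (inBlock x ∧ not (x ∈ᵇ v))) _ ⟩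
    free + ∑[ x < n ] 𝟙 (inBlock x ∧ (x ∈ᵇ v))                            ≤⟨ +-monoʳ-≤ free used≤taken ⟩
    free + taken                                                          ∎)
    where
    open ≤-Reasoning
    β : ℕ → ℕ
    β p = 𝟙 (sameBlock p s)
    inBlock : Fin n → Bool
    inBlock x = blockBox s {suc m} zero x
    free = ∑[ x < n ] 𝟙 (inBlock x ∧ not (x ∈ᵇ v))
    taken = ∑ℕ m (λ j → β (suc j + s))
    used≤taken : ∑[ x < n ] 𝟙 (inBlock x ∧ (x ∈ᵇ v)) ≤ taken
    used≤taken = begin
      ∑[ x < n ] 𝟙 (inBlock x ∧ (x ∈ᵇ v))     ≤⟨ ∑-𝟙-∈ᵇ≤ inBlock v ⟩
      ∑[ j < m ] 𝟙 (inBlock (lookup v j))     ≡⟨ sum-cong-≗ {m} (λ j → cong (λ b → 𝟙 (b ≡ᵇ s / k))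
                                                   (≡ᵇ⇒≡ (toℕ (lookup v j) / k) ((suc (toℕ j) + s) / k)
                                                     (≡true⇒T (inBox⁻ (blockBox s ∘ suc) v inside j)))) ⟩
      ∑[ j < m ] β (suc (toℕ j) + s)          ≡⟨ ∑-toℕ m (λ j → β (suc j + s)) ⟩
      taken                                   ∎

  -- Every injective σ keeping each point in its own block is a linear extension;
  -- choosing σ (n-1), …, σ 0 in turn, point i still has at least 1 + i mod k free places.
  ∏ℕ≤countDistinctInBlockBox : ∀ m s → s + m ≤ n →
    ∏ℕ m (λ j → suc ((j + s) % k)) ≤ countDistinctInBox n m (blockBox s)
  ∏ℕ≤countDistinctInBlockBox zero    s _     = ≤-refl
  ∏ℕ≤countDistinctInBlockBox (suc m) s s+m≤n = begin
    suc (s % k) * ∏ℕ m (λ j → suc ((suc j + s) % k))         ≡⟨ cong (suc (s % k) *_) (∏ℕ-cong m (λ j _ → cong (λ i → suc (i % k)) (+-suc j s))) ⟨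
    suc (s % k) * ∏ℕ m (λ j → suc ((j + suc s) % k))         ≤⟨ *-monoʳ-≤ (suc (s % k)) (∏ℕ≤countDistinctInBlockBox m (suc s) s+m≤n′) ⟩
    suc (s % k) * countDistinctInBox n m (blockBox (suc s))  ≡⟨ cong (suc (s % k) *_) (sumMap-cong (allVecs n m) shift) ⟩
    suc (s % k) * countDistinctInBox n m (blockBox s ∘ suc)  ≤⟨ countDistinctInBox-step n m (blockBox s) (suc (s % k)) (1+s%k≤choices s m s+m≤n′) ⟩
    countDistinctInBox n (suc m) (blockBox s)                ∎
    where
    open ≤-Reasoning
    s+m≤n′ : suc s + m ≤ n
    s+m≤n′ = subst (_≤ n) (+-suc s m) s+m≤n
    shift : ∀ v → 𝟙 (distinct v ∧ inBox (blockBox (suc s)) v) ≡ 𝟙 (distinct v ∧ inBox (blockBox s ∘ suc) v)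
    shift v = cong (λ b → 𝟙 (distinct v ∧ b))
      (inBox-cong (λ i p → cong (λ t → sameBlock (toℕ p) t) (+-suc (toℕ i) s)) v)

  _⊑ᵇ_ : Fin n → Fin n → Bool
  i ⊑ᵇ j = (i =ꟳ j) ∨ (toℕ i / k <ᵇ toℕ j / k)

  ⊑ᵇ-cases : ∀ i j → (i ⊑ᵇ j) ≡ true → (i ≡ j) ⊎ (toℕ i / k < toℕ j / k)
  ⊑ᵇ-cases i j h with i =ꟳ j in i=j
  ... | true  = inj₁ (=ꟳ⇒≡ i=j)
  ... | false = inj₂ (<ᵇ⇒<′ h)

  blockOrder : FinPoset n
  blockOrder = record { le = _⊑ᵇ_ ; refl = reflexive ; antisym = antisymmetric ; trans = transitive }
    where
    reflexive : ∀ i → (i ⊑ᵇ i) ≡ true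
    reflexive i = ∨-trueˡ (≡⇒=ꟳ {i = i} refl)
    antisymmetric : ∀ i j → (i ⊑ᵇ j) ≡ true → (j ⊑ᵇ i) ≡ true → i ≡ j
    antisymmetric i j i≤j j≤i with ⊑ᵇ-cases i j i≤j | ⊑ᵇ-cases j i j≤i
    ... | inj₁ i≡j | _        = i≡j
    ... | inj₂ _   | inj₁ j≡i = sym j≡i
    ... | inj₂ i<j | inj₂ j<i = ⊥-elim (<-asym i<j j<i)
    transitive : ∀ i j l → (i ⊑ᵇ j) ≡ true → (j ⊑ᵇ l) ≡ true → (i ⊑ᵇ l) ≡ true
    transitive i j l i≤j j≤l with ⊑ᵇ-cases i j i≤j | ⊑ᵇ-cases j l j≤l
    ... | inj₁ refl | _         = j≤l
    ... | inj₂ _    | inj₁ refl = i≤j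
    ... | inj₂ i<j  | inj₂ j<l  = ∨-trueʳ {i =ꟳ l} (<⇒<ᵇ′ (<-trans i<j j<l))

  distinctInBlockBox⇒linExt : ∀ σ → distinct σ ∧ inBox (blockBox 0) σ ≡ true → isLinExt blockOrder σ ≡ true
  distinctInBlockBox⇒linExt σ h =
    allB-tabulate⁺ _ (λ i → i) (λ i → allB-tabulate⁺ _ (λ j → j) (λ j → ∧-true (injective i j) (monotone i j)))
    where
    sameBlockAsPosition : ∀ i → toℕ (lookup σ i) / k ≡ toℕ i / k
    sameBlockAsPosition i = trans (≡ᵇ⇒≡ _ _ (≡true⇒T (inBox⁻ (blockBox 0) σ (∧-trueʳ {distinct σ} h) i)))
                                  (cong (_/ k) (+-identityʳ (toℕ i)))
    injective : ∀ i j → ((i =ꟳ j) ∨ not (lookup σ i =ꟳ lookup σ j)) ≡ true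
    injective i j with i =ꟳ j in i=j
    ... | true  = refl
    ... | false = not-false (≢true⇒≡false (λ σi=σj → true≢false
            (trans (sym (≡⇒=ꟳ (distinct⇒lookup-injective σ (∧-trueˡ h) i j (=ꟳ⇒≡ σi=σj)))) i=j)))
    monotone : ∀ i j → (not (i ⊑ᵇ j) ∨ not (lookup σ j <ꟳ lookup σ i)) ≡ true
    monotone i j with i ⊑ᵇ j in i≤j
    ... | false = refl
    ... | true with ⊑ᵇ-cases i j i≤j
    ...   | inj₁ refl = not-false (≮⇒<ᵇ-false {toℕ (lookup σ i)} (<-irrefl refl))
    ...   | inj₂ i<j  = not-false (≮⇒<ᵇ-false (λ σj<σi → <⇒≱
            (subst₂ _<_ (sym (sameBlockAsPosition i)) (sym (sameBlockAsPosition j)) i<j) (/-monoˡ-≤ k (<⇒≤ σj<σi))))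

  ∏ℕ[1+i%k]≤e-blockOrder : ∏ℕ n (λ i → suc (i % k)) ≤ e blockOrder
  ∏ℕ[1+i%k]≤e-blockOrder = begin
    ∏ℕ n (λ i → suc (i % k))               ≡⟨ ∏ℕ-cong n (λ i _ → cong (λ j → suc (j % k)) (+-identityʳ i)) ⟨
    ∏ℕ n (λ i → suc ((i + 0) % k))         ≤⟨ ∏ℕ≤countDistinctInBlockBox n 0 ≤-refl ⟩
    countDistinctInBox n n (blockBox 0)    ≤⟨ sumMap-mono-≤ (allVecs n n) (λ σ → 𝟙-mono (distinctInBlockBox⇒linExt σ)) ⟩
    sumVecs n n (𝟙 ∘ isLinExt blockOrder)  ≡⟨ e≡sumVecs blockOrder ⟨
    e blockOrder                           ∎
    where open ≤-Reasoning

  k^n≤8^n*e-blockOrder : k ≤ n → k ^ n ≤ 8 ^ n * e blockOrder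
  k^n≤8^n*e-blockOrder k≤n = ≤-trans (k^n≤8^n*∏ℕ[1+i%k] k n k≤n) (*-monoʳ-≤ (8 ^ n) ∏ℕ[1+i%k]≤e-blockOrder)

  <ꟳ⇒comparable⊎near : ∀ i j → 𝟙 (i <ꟳ j)
    ≤ 𝟙 ((i <ꟳ j) ∧ ((i ⊑ᵇ j) ∨ (j ⊑ᵇ i))) + 𝟙 (inRange (suc (toℕ i)) (toℕ i + k) (toℕ j))
  <ꟳ⇒comparable⊎near i j with i <ꟳ j in i<j
  ... | false = z≤n
  ... | true with toℕ i / k <ᵇ toℕ j / k in blocks<
  ...   | true  rewrite ∨-zeroʳ (i =ꟳ j) = s≤s z≤n
  ...   | false = ≤-trans (≤-reflexive (cong 𝟙 (sym (<⇒<ᵇ′ j<i+k)))) (m≤n+m _ _)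
    where
    sameBlock′ : toℕ j / k ≡ toℕ i / k
    sameBlock′ = ≤-antisym (≮⇒≥ (λ lt → true≢false (trans (sym (<⇒<ᵇ′ lt)) blocks<))) (/-monoˡ-≤ k (<⇒≤ (<ꟳ⇒< {i = i} {j} i<j)))
    j<i+k : toℕ j < toℕ i + k
    j<i+k = begin-strict
      toℕ j                      ≡⟨ m≡m%n+[m/n]*n (toℕ j) k ⟩
      toℕ j % k + toℕ j / k * k  <⟨ +-monoˡ-< _ (m%n<n (toℕ j) k) ⟩
      k + toℕ j / k * k          ≡⟨ cong (λ b → k + b * k) sameBlock′ ⟩
      k + toℕ i / k * k          ≤⟨ +-monoʳ-≤ k (m/n*n≤m (toℕ i) k) ⟩
      k + toℕ i                  ≡⟨ +-comm k (toℕ i) ⟩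
      toℕ i + k                  ∎
      where open ≤-Reasoning

  nC2≤comp-blockOrder+n*[k∸1] : n C 2 ≤ comp blockOrder + n * (k ∸ 1)
  nC2≤comp-blockOrder+n*[k∸1] = begin
    n C 2                                                   ≡⟨ ∑∑𝟙[i<j]≡nC2 n ⟨
    ∑[ i < n ] ∑[ j < n ] 𝟙 (i <ꟳ j)                        ≤⟨ ∑-mono-≤ (λ i → ∑-mono-≤ (λ j → <ꟳ⇒comparable⊎near i j)) ⟩
    ∑[ i < n ] ∑[ j < n ] (comparable i j + near i j)        ≡⟨ sum-cong-≗ {n} (λ i → ∑-distrib-+ (comparable i) (near i)) ⟩
    ∑[ i < n ] (∑[ j < n ] comparable i j + ∑[ j < n ] near i j)
                                                            ≡⟨ ∑-distrib-+ (λ i → ∑[ j < n ] comparable i j) _ ⟩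
    ∑[ i < n ] ∑[ j < n ] comparable i j + ∑[ i < n ] ∑[ j < n ] near i j
                                                            ≤⟨ +-mono-≤ (≤-reflexive (sym (comp≡∑ blockOrder))) (∑-mono-≤ near≤k∸1) ⟩
    comp blockOrder + ∑[ i < n ] (k ∸ 1)                    ≡⟨ cong (comp blockOrder +_) (∑-const n (k ∸ 1)) ⟩
    comp blockOrder + n * (k ∸ 1)                           ∎
    where
    open ≤-Reasoning
    comparable near : Fin n → Fin n → ℕ
    comparable i j = 𝟙 ((i <ꟳ j) ∧ ((i ⊑ᵇ j) ∨ (j ⊑ᵇ i)))
    near i j = 𝟙 (inRange (suc (toℕ i)) (toℕ i + k) (toℕ j))
    i+k∸[1+i]≡k∸1 : ∀ i → i + k ∸ suc i ≡ k ∸ 1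
    i+k∸[1+i]≡k∸1 zero    = refl
    i+k∸[1+i]≡k∸1 (suc i) = i+k∸[1+i]≡k∸1 i
    near≤k∸1 : ∀ i → ∑[ j < n ] near i j ≤ k ∸ 1
    near≤k∸1 i = begin
      ∑[ j < n ] near i j                           ≡⟨ ∑-toℕ n (𝟙 ∘ inRange (suc (toℕ i)) (toℕ i + k)) ⟩
      ∑ℕ n (𝟙 ∘ inRange (suc (toℕ i)) (toℕ i + k))  ≤⟨ ∑ℕ-inRange-≤ n (suc (toℕ i)) (toℕ i + k) ⟩
      toℕ i + k ∸ suc (toℕ i)                       ≡⟨ i+k∸[1+i]≡k∸1 (toℕ i) ⟩
      k ∸ 1                                         ∎

module RationalArithmetic where

  open import Data.Rational
  open import Data.Rational.Properties
  open import Data.Rational.Solver using (module +-*-Solver)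
  import Data.Nat as ℕ
  import Data.Integer as ℤ
  import Data.Integer.Properties as ℤ
  open import Data.Integer using (+_)
  open import Data.Nat.Coprimality using (1-coprimeTo) renaming (sym to coprime-sym)
  open import Relation.Binary.PropositionalEquality
  open +-*-Solver

  ℕtoℚ≡mkℚ : ∀ a → ℕtoℚ a ≡ mkℚ (+ a) 0 (coprime-sym (1-coprimeTo a))
  ℕtoℚ≡mkℚ a = normalize-coprime (coprime-sym (1-coprimeTo a))

  ℕtoℚ-+ : ∀ a b → ℕtoℚ (a ℕ.+ b) ≡ ℕtoℚ a + ℕtoℚ b
  ℕtoℚ-+ a b rewrite ℕtoℚ≡mkℚ a | ℕtoℚ≡mkℚ b =
    sym (cong₂ (λ x y → (x ℤ.+ y) / 1) (ℤ.*-identityʳ (+ a)) (ℤ.*-identityʳ (+ b)))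

  ℕtoℚ-* : ∀ a b → ℕtoℚ (a ℕ.* b) ≡ ℕtoℚ a * ℕtoℚ b
  ℕtoℚ-* a b rewrite ℕtoℚ≡mkℚ a | ℕtoℚ≡mkℚ b = cong (_/ 1) (ℤ.pos-* a b)

  ℕtoℚ-^ : ∀ a n → ℕtoℚ (a ℕ.^ n) ≡ ℕtoℚ a ^ℚ n
  ℕtoℚ-^ a ℕ.zero    = refl
  ℕtoℚ-^ a (ℕ.suc n) = trans (ℕtoℚ-* a (a ℕ.^ n)) (cong (ℕtoℚ a *_) (ℕtoℚ-^ a n))

  ℕtoℚ-mono-≤ : ∀ {a b} → a ℕ.≤ b → ℕtoℚ a ≤ ℕtoℚ b
  ℕtoℚ-mono-≤ {a} {b} a≤b rewrite ℕtoℚ≡mkℚ a | ℕtoℚ≡mkℚ b =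
    *≤* (subst₂ ℤ._≤_ (sym (ℤ.*-identityʳ (+ a))) (sym (ℤ.*-identityʳ (+ b))) (ℤ.+≤+ a≤b))

  ℕtoℚ-cancel-≤ : ∀ {a b} → ℕtoℚ a ≤ ℕtoℚ b → a ℕ.≤ b
  ℕtoℚ-cancel-≤ {a} {b} a≤b rewrite ℕtoℚ≡mkℚ a | ℕtoℚ≡mkℚ b =
    ℤ.drop‿+≤+ (subst₂ ℤ._≤_ (ℤ.*-identityʳ (+ a)) (ℤ.*-identityʳ (+ b)) (drop-*≤* a≤b))

  0≤ℕtoℚ : ∀ a → 0ℚ ≤ ℕtoℚ a
  0≤ℕtoℚ a = ℕtoℚ-mono-≤ {0} {a} ℕ.z≤n

  0≤* : ∀ {p q} → 0ℚ ≤ p → 0ℚ ≤ q → 0ℚ ≤ p * q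
  0≤* {p} {q} 0≤p 0≤q = nonNegative⁻¹ (p * q) {{nonNeg*nonNeg⇒nonNeg p {{nonNegative 0≤p}} q {{nonNegative 0≤q}}}}

  ^ℚ-distribʳ-* : ∀ p q n → (p * q) ^ℚ n ≡ p ^ℚ n * q ^ℚ n
  ^ℚ-distribʳ-* p q ℕ.zero    = sym (*-identityʳ 1ℚ)
  ^ℚ-distribʳ-* p q (ℕ.suc n) = trans (cong ((p * q) *_) (^ℚ-distribʳ-* p q n)) (interchange p q (p ^ℚ n) (q ^ℚ n))
    where
    interchange : ∀ a b c d → (a * b) * (c * d) ≡ (a * c) * (b * d)
    interchange = solve 4 (λ a b c d → (a :* b) :* (c :* d) := (a :* c) :* (b :* d)) refl

  1^ℚ : ∀ n → 1ℚ ^ℚ n ≡ 1ℚ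
  1^ℚ ℕ.zero    = refl
  1^ℚ (ℕ.suc n) = trans (cong (1ℚ *_) (1^ℚ n)) (*-identityˡ 1ℚ)

  0≤^ℚ : ∀ {p} n → 0ℚ ≤ p → 0ℚ ≤ p ^ℚ n
  0≤^ℚ ℕ.zero    0≤p = nonNegative⁻¹ 1ℚ
  0≤^ℚ (ℕ.suc n) 0≤p = 0≤* 0≤p (0≤^ℚ n 0≤p)

  ^ℚ-monoˡ-≤ : ∀ {p q} n → 0ℚ ≤ p → p ≤ q → p ^ℚ n ≤ q ^ℚ n
  ^ℚ-monoˡ-≤ ℕ.zero    0≤p p≤q = ≤-refl
  ^ℚ-monoˡ-≤ {p} {q} (ℕ.suc n) 0≤p p≤q = ≤-trans
    (*-monoʳ-≤-nonNeg (p ^ℚ n) {{nonNegative (0≤^ℚ n 0≤p)}} p≤q)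
    (*-monoˡ-≤-nonNeg q {{nonNegative (≤-trans 0≤p p≤q)}} (^ℚ-monoˡ-≤ n 0≤p p≤q))

  p≤q⇒0≤q-p : ∀ {p q} → p ≤ q → 0ℚ ≤ q - p
  p≤q⇒0≤q-p {p} h = ≤-trans (≤-reflexive (sym (+-inverseʳ p))) (+-monoˡ-≤ (- p) h)

  0≤q-p⇒p≤q : ∀ {p q} → 0ℚ ≤ q - p → p ≤ q
  0≤q-p⇒p≤q {p} {q} h = ≤-trans (≤-reflexive (sym (+-identityˡ p))) (≤-trans (+-monoˡ-≤ p h) (≤-reflexive (cancel q p)))
    where
    cancel : ∀ a b → (a - b) + b ≡ a
    cancel = solve 2 (λ a b → (a :- b) :+ b := a) refl

  p+q≤r⇒p≤r-q : ∀ {p q r} → p + q ≤ r → p ≤ r - q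
  p+q≤r⇒p≤r-q {p} {q} {r} h = 0≤q-p⇒p≤q (subst (0ℚ ≤_) (regroup p q r) (p≤q⇒0≤q-p h))
    where
    regroup : ∀ p q r → r - (p + q) ≡ (r - q) - p
    regroup = solve 3 (λ p q r → r :- (p :+ q) := (r :- q) :- p) refl

  0≤inv : ∀ n → 0ℚ ≤ inv n
  0≤inv ℕ.zero    = ≤-refl
  0≤inv (ℕ.suc m) = nonNegative⁻¹ (+ 1 / ℕ.suc m) {{normalize-nonNeg 1 (ℕ.suc m)}}

  inv*ℕtoℚ≡1 : ∀ m → inv (ℕ.suc m) * ℕtoℚ (ℕ.suc m) ≡ 1ℚ
  inv*ℕtoℚ≡1 m = trans (cong₂ _*_ (normalize-coprime (1-coprimeTo (ℕ.suc m))) (ℕtoℚ≡mkℚ (ℕ.suc m))) (*-inverseˡ (mkℚ (+ ℕ.suc m) 0 (coprime-sym (1-coprimeTo (ℕ.suc m)))))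

  p+p≤q+q⇒p≤q : ∀ {p q} → p + p ≤ q + q → p ≤ q
  p+p≤q+q⇒p≤q {p} {q} h = 0≤q-p⇒p≤q (subst (0ℚ ≤_) (halve p q) (0≤* (nonNegative⁻¹ ½) (p≤q⇒0≤q-p h)))
    where
    halve : ∀ p q → ½ * ((q + q) - (p + p)) ≡ q - p
    halve = solve 2 (λ p q → con ½ :* ((q :+ q) :- (p :+ p)) := q :- p) refl

module Bounds where

  open import Data.Rational
  open import Data.Rational.Properties
  open import Data.Rational.Solver using (module +-*-Solver)
  import Data.Nat as ℕ
  import Data.Nat.Properties as ℕ
  open import Data.Nat.Combinatorics using (_C_)
  open import Data.Integer using (+_; +<+)
  open import Data.Product using (Σ; _×_; _,_)
  open import Data.Empty using (⊥-elim)
  open import Relation.Nullary using (¬_; yes; no)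
  open import Relation.Unary using (Decidable)
  open import Relation.Binary.PropositionalEquality
  open +-*-Solver
  open RationalArithmetic
  open Sums using ([1+m]C2+[1+m]C2≡[1+m]*m)

  1/8 1/24 : ℚ
  1/8  = + 1 / 8
  1/24 = + 1 / 24

  crossing : ∀ {P : ℕ → Set} → Decidable P → P 0 → ∀ B → ¬ P B → Σ ℕ λ t → t ℕ.< B × P t × ¬ P (ℕ.suc t)
  crossing P? P0 ℕ.zero    ¬PB = ⊥-elim (¬PB P0)
  crossing P? P0 (ℕ.suc B) ¬PB with P? B
  ... | yes PB = B , ℕ.≤-refl , PB , ¬PB
  ... | no ¬PB′ with crossing P? P0 B ¬PB′
  ...   | t , t<B , Pt , ¬Pt+1 = t , ℕ.m≤n⇒m≤1+n t<B , Pt , ¬Pt+1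

  module _ (d : ℚ) (0≤d : 0ℚ ≤ d) (d≤1 : d ≤ 1ℚ) (m : ℕ) where

    private
      n = ℕ.suc m
      N = ℕtoℚ n
      μ = M d n

    N≡1+m : N ≡ 1ℚ + ℕtoℚ m
    N≡1+m = ℕtoℚ-+ 1 m

    0≤1-d : 0ℚ ≤ 1ℚ - d
    0≤1-d = p≤q⇒0≤q-p d≤1

    1-d≤1 : 1ℚ - d ≤ 1ℚ
    1-d≤1 = 0≤q-p⇒p≤q (subst (0ℚ ≤_) (sym (cancel d)) 0≤d)
      where
      cancel : ∀ x → 1ℚ - (1ℚ - x) ≡ x
      cancel = solve 1 (λ x → con 1ℚ :- (con 1ℚ :- x) := x) refl

    1-d≤μ : 1ℚ - d ≤ μ
    1-d≤μ = p≤p⊔q (1ℚ - d) (inv n)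

    1/n≤μ : inv n ≤ μ
    1/n≤μ = p≤q⊔p (1ℚ - d) (inv n)

    0≤μ : 0ℚ ≤ μ
    0≤μ = ≤-trans (0≤inv n) 1/n≤μ

    1≤μN : 1ℚ ≤ μ * N
    1≤μN = subst (_≤ μ * N) (inv*ℕtoℚ≡1 m) (*-monoʳ-≤-nonNeg N {{nonNegative (0≤ℕtoℚ n)}} 1/n≤μ)

    a≤3μN : ∀ a c → a ℕ.* n ℕ.+ (c ℕ.+ c) ℕ.≤ n ℕ.* n ℕ.+ n → δbinom d n ≤ ℕtoℚ c → ℕtoℚ a ≤ ℕtoℚ 3 * μ * N
    a≤3μN a c counting dense = *-cancelʳ-≤-pos N {{positive 0<N}} (begin
      A * N                                        ≤⟨ p+q≤r⇒p≤r-q (≤-trans (+-monoʳ-≤ (A * N) d*N*m≤2c) counting′) ⟩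
      (N * N + N) - d * (N * ℕtoℚ m)               ≡⟨ subst (λ z → (z * z + z) - d * (z * ℕtoℚ m) ≡ (1ℚ - d) * (z * z) + (1ℚ + d) * z)
                                                          (sym N≡1+m) (expand (ℕtoℚ m) d) ⟩
      (1ℚ - d) * (N * N) + (1ℚ + d) * N            ≤⟨ +-mono-≤ (*-monoʳ-≤-nonNeg (N * N) {{nonNegative (0≤* (0≤ℕtoℚ n) (0≤ℕtoℚ n))}} 1-d≤μ)
                                                               (*-monoʳ-≤-nonNeg N {{nonNegative (0≤ℕtoℚ n)}} 1+d≤2μN) ⟩
      μ * (N * N) + (ℕtoℚ 2 * (μ * N)) * N         ≡⟨ collect μ N ⟩
      (ℕtoℚ 3 * μ * N) * N                         ∎)
      where
      open ≤-Reasoning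
      A = ℕtoℚ a
      c′ = ℕtoℚ c
      0<N : 0ℚ < N
      0<N = subst (0ℚ <_) (sym (ℕtoℚ≡mkℚ n)) (*<* (+<+ (ℕ.s≤s ℕ.z≤n)))
      counting′ : A * N + (c′ + c′) ≤ N * N + N
      counting′ = subst₂ _≤_ (trans (ℕtoℚ-+ (a ℕ.* n) _) (cong₂ _+_ (ℕtoℚ-* a n) (ℕtoℚ-+ c c)))
                             (trans (ℕtoℚ-+ (n ℕ.* n) n) (cong (_+ N) (ℕtoℚ-* n n))) (ℕtoℚ-mono-≤ counting)
      d*N*m≤2c : d * (N * ℕtoℚ m) ≤ c′ + c′
      d*N*m≤2c = begin
        d * (N * ℕtoℚ m)                   ≡⟨ cong (d *_) (trans (sym (ℕtoℚ-* n m)) (trans (cong ℕtoℚ (sym ([1+m]C2+[1+m]C2≡[1+m]*m m))) (ℕtoℚ-+ (n C 2) (n C 2)))) ⟩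
        d * (ℕtoℚ (n C 2) + ℕtoℚ (n C 2))  ≡⟨ *-distribˡ-+ d _ _ ⟩
        δbinom d n + δbinom d n            ≤⟨ +-mono-≤ dense dense ⟩
        c′ + c′                            ∎
      1+d≤2μN : 1ℚ + d ≤ ℕtoℚ 2 * (μ * N)
      1+d≤2μN = ≤-trans (+-monoʳ-≤ 1ℚ d≤1) (≤-trans (≤-reflexive (two 1ℚ)) (*-monoˡ-≤-nonNeg (ℕtoℚ 2) {{nonNegative (0≤ℕtoℚ 2)}} 1≤μN))
        where
        two : ∀ x → x + x ≡ ℕtoℚ 2 * x
        two = solve 1 (λ x → x :+ x := con (ℕtoℚ 2) :* x) refl
      expand : ∀ q d → ((1ℚ + q) * (1ℚ + q) + (1ℚ + q)) - d * ((1ℚ + q) * q)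
                       ≡ (1ℚ - d) * ((1ℚ + q) * (1ℚ + q)) + (1ℚ + d) * (1ℚ + q)
      expand = solve 2 (λ q d → ((con 1ℚ :+ q) :* (con 1ℚ :+ q) :+ (con 1ℚ :+ q)) :- d :* ((con 1ℚ :+ q) :* q)
                                 := (con 1ℚ :- d) :* ((con 1ℚ :+ q) :* (con 1ℚ :+ q)) :+ (con 1ℚ :+ d) :* (con 1ℚ :+ q)) refl
      collect : ∀ x y → x * (y * y) + (ℕtoℚ 2 * (x * y)) * y ≡ (ℕtoℚ 3 * x * y) * y
      collect = solve 2 (λ x y → x :* (y :* y) :+ (con (ℕtoℚ 2) :* (x :* y)) :* y := (con (ℕtoℚ 3) :* x :* y) :* y) refl

    N^n≤4^n*n! : N ^ℚ n ≤ ℕtoℚ 4 ^ℚ n * ℕtoℚ (n ℕ.!)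
    N^n≤4^n*n! = subst₂ _≤_ (ℕtoℚ-^ n n) (trans (ℕtoℚ-* (4 ℕ.^ n) (n ℕ.!)) (cong (_* ℕtoℚ (n ℕ.!)) (ℕtoℚ-^ 4 n)))
                   (ℕtoℚ-mono-≤ (Estimates.m^m≤4^m*m! n))

    counting⇒upper : ∀ ε c a → ε ℕ.≤ (2 ℕ.* a) ℕ.^ n → a ℕ.* n ℕ.+ (c ℕ.+ c) ℕ.≤ n ℕ.* n ℕ.+ n →
      δbinom d n ≤ ℕtoℚ c → ℕtoℚ ε ≤ ((ℕtoℚ 24 * μ) ^ℚ n) * ℕtoℚ (n ℕ.!)
    counting⇒upper ε c a ε≤[2a]^n counting dense = begin
      ℕtoℚ ε                                            ≤⟨ ℕtoℚ-mono-≤ ε≤[2a]^n ⟩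
      ℕtoℚ ((2 ℕ.* a) ℕ.^ n)                            ≡⟨ trans (ℕtoℚ-^ (2 ℕ.* a) n) (cong (_^ℚ n) (ℕtoℚ-* 2 a)) ⟩
      (ℕtoℚ 2 * ℕtoℚ a) ^ℚ n                            ≤⟨ ^ℚ-monoˡ-≤ n (0≤* (0≤ℕtoℚ 2) (0≤ℕtoℚ a)) 2a≤6μN ⟩
      ((ℕtoℚ 6 * μ) * N) ^ℚ n                           ≡⟨ ^ℚ-distribʳ-* (ℕtoℚ 6 * μ) N n ⟩
      (ℕtoℚ 6 * μ) ^ℚ n * N ^ℚ n                        ≤⟨ *-monoˡ-≤-nonNeg ((ℕtoℚ 6 * μ) ^ℚ n) {{nonNegative (0≤^ℚ n 0≤6μ)}} N^n≤4^n*n! ⟩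
      (ℕtoℚ 6 * μ) ^ℚ n * (ℕtoℚ 4 ^ℚ n * ℕtoℚ (n ℕ.!))  ≡⟨ *-assoc ((ℕtoℚ 6 * μ) ^ℚ n) (ℕtoℚ 4 ^ℚ n) (ℕtoℚ (n ℕ.!)) ⟨
      (ℕtoℚ 6 * μ) ^ℚ n * ℕtoℚ 4 ^ℚ n * ℕtoℚ (n ℕ.!)    ≡⟨ cong (_* ℕtoℚ (n ℕ.!)) (trans (sym (^ℚ-distribʳ-* (ℕtoℚ 6 * μ) (ℕtoℚ 4) n))
                                                                                       (cong (_^ℚ n) (six*four μ))) ⟩
      (ℕtoℚ 24 * μ) ^ℚ n * ℕtoℚ (n ℕ.!)                 ∎
      where
      open ≤-Reasoning
      0≤6μ : 0ℚ ≤ ℕtoℚ 6 * μ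
      0≤6μ = 0≤* (0≤ℕtoℚ 6) 0≤μ
      2a≤6μN : ℕtoℚ 2 * ℕtoℚ a ≤ (ℕtoℚ 6 * μ) * N
      2a≤6μN = ≤-trans (*-monoˡ-≤-nonNeg (ℕtoℚ 2) {{nonNegative (0≤ℕtoℚ 2)}} (a≤3μN a c counting dense))
                       (≤-reflexive (double μ N))
        where
        double : ∀ x y → ℕtoℚ 2 * (ℕtoℚ 3 * x * y) ≡ (ℕtoℚ 6 * x) * y
        double = solve 2 (λ x y → con (ℕtoℚ 2) :* (con (ℕtoℚ 3) :* x :* y) := (con (ℕtoℚ 6) :* x) :* y) refl
      six*four : ∀ x → ℕtoℚ 6 * x * ℕtoℚ 4 ≡ ℕtoℚ 24 * x
      six*four = solve 1 (λ x → con (ℕtoℚ 6) :* x :* con (ℕtoℚ 4) := con (ℕtoℚ 24) :* x) refl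

    upper : (Q : FinPoset n) → δbinom d n ≤ ℕtoℚ (comp Q) → ℕtoℚ (e Q) ≤ ((ℕtoℚ 24 * μ) ^ℚ n) * ℕtoℚ (n ℕ.!)
    upper Q dense = let a , e≤[2a]^n , counting = UpperBound.linExt-upperBound Q in counting⇒upper (e Q) (comp Q) a e≤[2a]^n counting dense

    blockOrder-dense : ∀ t → ℕtoℚ (t ℕ.+ t) ≤ (1ℚ - d) * ℕtoℚ m →
      δbinom d n ≤ ℕtoℚ (comp (BlockOrder.blockOrder (ℕ.suc t) n))
    blockOrder-dense t 2t≤x = begin
      d * B                 ≤⟨ p+q≤r⇒p≤r-q (≤-trans (+-monoʳ-≤ (d * B) NT≤[1-d]B) (≤-trans (≤-reflexive (split d B)) nC2≤comp+NT)) ⟩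
      (c′ + N * T) - N * T  ≡⟨ cancel c′ (N * T) ⟩
      c′                    ∎
      where
      open ≤-Reasoning
      Q = BlockOrder.blockOrder (ℕ.suc t) n
      B = ℕtoℚ (n C 2)
      T = ℕtoℚ t
      c′ = ℕtoℚ (comp Q)
      nC2≤comp+NT : B ≤ c′ + N * T
      nC2≤comp+NT = subst (B ≤_) (trans (ℕtoℚ-+ (comp Q) (n ℕ.* t)) (cong (λ z → c′ + z) (ℕtoℚ-* n t)))
                      (ℕtoℚ-mono-≤ (BlockOrder.nC2≤comp-blockOrder+n*[k∸1] (ℕ.suc t) n))
      NT≤[1-d]B : N * T ≤ (1ℚ - d) * B
      NT≤[1-d]B = p+p≤q+q⇒p≤q (begin
        N * T + N * T                  ≡⟨ *-distribˡ-+ N T T ⟨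
        N * (T + T)                    ≤⟨ *-monoˡ-≤-nonNeg N {{nonNegative (0≤ℕtoℚ n)}} (subst (_≤ (1ℚ - d) * ℕtoℚ m) (ℕtoℚ-+ t t) 2t≤x) ⟩
        N * ((1ℚ - d) * ℕtoℚ m)        ≡⟨ swap N (1ℚ - d) (ℕtoℚ m) ⟩
        (1ℚ - d) * (N * ℕtoℚ m)        ≡⟨ cong ((1ℚ - d) *_) (trans (sym (ℕtoℚ-* n m))
                                            (trans (cong ℕtoℚ (sym ([1+m]C2+[1+m]C2≡[1+m]*m m))) (ℕtoℚ-+ (n C 2) (n C 2)))) ⟩
        (1ℚ - d) * (B + B)             ≡⟨ *-distribˡ-+ (1ℚ - d) B B ⟩
        (1ℚ - d) * B + (1ℚ - d) * B    ∎)
        where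
        swap : ∀ a b c → a * (b * c) ≡ b * (a * c)
        swap = solve 3 (λ a b c → a :* (b :* c) := b :* (a :* c)) refl
      split : ∀ d b → d * b + (1ℚ - d) * b ≡ b
      split = solve 2 (λ d b → d :* b :+ (con 1ℚ :- d) :* b := b) refl
      cancel : ∀ a b → (a + b) - b ≡ a
      cancel = solve 2 (λ a b → (a :+ b) :- b := a) refl

    μN≤3[1+t] : ∀ t → (1ℚ - d) * ℕtoℚ m ≤ ℕtoℚ (ℕ.suc t ℕ.+ ℕ.suc t) → μ * N ≤ ℕtoℚ 3 * ℕtoℚ (ℕ.suc t)
    μN≤3[1+t] t x≤2k = subst (_≤ ℕtoℚ 3 * K) (sym (*-distribʳ-⊔-nonNeg N {{nonNegative (0≤ℕtoℚ n)}} (1ℚ - d) (inv n)))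
      (⊔-lub [1-d]N≤3K (subst (_≤ ℕtoℚ 3 * K) (sym (inv*ℕtoℚ≡1 m)) (≤-trans 1≤K K≤3K)))
      where
      open ≤-Reasoning
      k = ℕ.suc t
      K = ℕtoℚ k
      1≤K : 1ℚ ≤ K
      1≤K = ℕtoℚ-mono-≤ {1} {k} (ℕ.s≤s ℕ.z≤n)
      [1-d]N≤3K : (1ℚ - d) * N ≤ ℕtoℚ 3 * K
      [1-d]N≤3K = begin
        (1ℚ - d) * N                          ≡⟨ trans (cong ((1ℚ - d) *_) N≡1+m) (*-distribˡ-+ (1ℚ - d) 1ℚ (ℕtoℚ m)) ⟩
        (1ℚ - d) * 1ℚ + (1ℚ - d) * ℕtoℚ m     ≤⟨ +-mono-≤ (≤-trans (≤-reflexive (*-identityʳ (1ℚ - d))) (≤-trans 1-d≤1 1≤K))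
                                                           (≤-trans x≤2k (≤-reflexive (ℕtoℚ-+ k k))) ⟩
        K + (K + K)                           ≡⟨ three K ⟩
        ℕtoℚ 3 * K                            ∎
        where
        three : ∀ a → a + (a + a) ≡ ℕtoℚ 3 * a
        three = solve 1 (λ a → a :+ (a :+ a) := con (ℕtoℚ 3) :* a) refl
      K≤3K : K ≤ ℕtoℚ 3 * K
      K≤3K = ≤-trans (≤-reflexive (sym (*-identityˡ K)))
               (*-monoʳ-≤-nonNeg K {{nonNegative (0≤ℕtoℚ k)}} (ℕtoℚ-mono-≤ {1} {3} (ℕ.s≤s ℕ.z≤n)))

    blockOrder-many : ∀ t → t ℕ.< n → (1ℚ - d) * ℕtoℚ m ≤ ℕtoℚ (ℕ.suc t ℕ.+ ℕ.suc t) →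
      ((1/24 * μ) ^ℚ n) * ℕtoℚ (n ℕ.!) ≤ ℕtoℚ (e (BlockOrder.blockOrder (ℕ.suc t) n))
    blockOrder-many t t<n x≤2k = begin
      (1/24 * μ) ^ℚ n * ℕtoℚ (n ℕ.!)         ≤⟨ *-monoˡ-≤-nonNeg ((1/24 * μ) ^ℚ n) {{nonNegative (0≤^ℚ n 0≤μ/24)}} n!≤N^n ⟩
      (1/24 * μ) ^ℚ n * N ^ℚ n               ≡⟨ ^ℚ-distribʳ-* (1/24 * μ) N n ⟨
      (1/24 * μ * N) ^ℚ n                    ≤⟨ ^ℚ-monoˡ-≤ n (0≤* 0≤μ/24 (0≤ℕtoℚ n)) μN/24≤K/8 ⟩
      (1/8 * K) ^ℚ n                         ≡⟨ trans (^ℚ-distribʳ-* 1/8 K n) (cong (1/8 ^ℚ n *_) (sym (ℕtoℚ-^ k n))) ⟩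
      1/8 ^ℚ n * ℕtoℚ (k ℕ.^ n)              ≤⟨ *-monoˡ-≤-nonNeg (1/8 ^ℚ n) {{nonNegative (0≤^ℚ n (nonNegative⁻¹ 1/8))}} (ℕtoℚ-mono-≤ (BlockOrder.k^n≤8^n*e-blockOrder k n t<n)) ⟩
      1/8 ^ℚ n * ℕtoℚ (8 ℕ.^ n ℕ.* e Q)      ≡⟨ cong (1/8 ^ℚ n *_) (trans (ℕtoℚ-* (8 ℕ.^ n) (e Q)) (cong (_* ℕtoℚ (e Q)) (ℕtoℚ-^ 8 n))) ⟩
      1/8 ^ℚ n * (ℕtoℚ 8 ^ℚ n * ℕtoℚ (e Q))  ≡⟨ *-assoc (1/8 ^ℚ n) (ℕtoℚ 8 ^ℚ n) (ℕtoℚ (e Q)) ⟨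
      1/8 ^ℚ n * ℕtoℚ 8 ^ℚ n * ℕtoℚ (e Q)    ≡⟨ cong (_* ℕtoℚ (e Q)) (trans (sym (^ℚ-distribʳ-* 1/8 (ℕtoℚ 8) n)) (1^ℚ n)) ⟩
      1ℚ * ℕtoℚ (e Q)                        ≡⟨ *-identityˡ (ℕtoℚ (e Q)) ⟩
      ℕtoℚ (e Q)                             ∎
      where
      open ≤-Reasoning
      k = ℕ.suc t
      K = ℕtoℚ k
      Q = BlockOrder.blockOrder k n
      0≤μ/24 : 0ℚ ≤ 1/24 * μ
      0≤μ/24 = 0≤* (nonNegative⁻¹ 1/24) 0≤μ
      n!≤N^n : ℕtoℚ (n ℕ.!) ≤ N ^ℚ n
      n!≤N^n = subst (ℕtoℚ (n ℕ.!) ≤_) (ℕtoℚ-^ n n) (ℕtoℚ-mono-≤ (Estimates.n!≤n^n n))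
      μN/24≤K/8 : 1/24 * μ * N ≤ 1/8 * K
      μN/24≤K/8 = ≤-trans (≤-reflexive (*-assoc 1/24 μ N))
        (≤-trans (*-monoˡ-≤-nonNeg 1/24 {{nonNegative (nonNegative⁻¹ 1/24)}} (μN≤3[1+t] t x≤2k)) (≤-reflexive (third K)))
        where
        third : ∀ a → 1/24 * (ℕtoℚ 3 * a) ≡ 1/8 * a
        third = solve 1 (λ a → con 1/24 :* (con (ℕtoℚ 3) :* a) := con 1/8 :* a) refl

    lower : Σ (FinPoset n) λ Q → (δbinom d n ≤ ℕtoℚ (comp Q)) × (((1/24 * μ) ^ℚ n) * ℕtoℚ (n ℕ.!) ≤ ℕtoℚ (e Q))
    lower = let t , t<n , 2t≤x , ¬2k≤x = crossing (λ t → ℕtoℚ (t ℕ.+ t) ≤? x) (0≤* 0≤1-d (0≤ℕtoℚ m)) n ¬2n≤x in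
      BlockOrder.blockOrder (ℕ.suc t) n , blockOrder-dense t 2t≤x , blockOrder-many t t<n (<⇒≤ (≰⇒> ¬2k≤x))
      where
      x = (1ℚ - d) * ℕtoℚ m
      ¬2n≤x : ¬ (ℕtoℚ (n ℕ.+ n) ≤ x)
      ¬2n≤x 2n≤x = ℕ.<⇒≱ (ℕ.m≤m+n n n) (ℕtoℚ-cancel-≤ (≤-trans 2n≤x
        (≤-trans (*-monoʳ-≤-nonNeg (ℕtoℚ m) {{nonNegative (0≤ℕtoℚ m)}} 1-d≤1) (≤-reflexive (*-identityˡ (ℕtoℚ m))))))

open import Data.Nat using (ℕ; _≤_)
open import Data.Nat using (_!)
open import Data.Product using (Σ; ∃; _×_)
open import Data.Rational using (ℚ; 0ℚ; 1ℚ; _-_; _*_) renaming (_<_ to _<ℚ_; _≤_ to _≤ℚ_)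
open import Data.Nat using (suc; s≤s; z≤n)
open import Data.Integer using (+<+)
open import Data.Product using (_,_)
open import Data.Rational using (*<*)
open import Data.Rational.Properties using (<⇒≤)

proposition4p4 :
    (δ : ℕ → ℚ) →
    (∀ n → (0ℚ <ℚ δ n) × (δ n <ℚ 1ℚ)) →
    (∀ (ε : ℚ) → 0ℚ <ℚ ε → ∃ λ N → ∀ n → N ≤ n → (1ℚ - δ n) <ℚ ε) →
    Σ ℚ λ c → Σ ℚ λ C → (0ℚ <ℚ c) × (0ℚ <ℚ C) × (∃ λ N → ∀ n → N ≤ n →
      ((∀ (Q : FinPoset n) → δbinom (δ n) n ≤ℚ ℕtoℚ (comp Q) →
          ℕtoℚ (e Q) ≤ℚ ((C * M (δ n) n) ^ℚ n) * ℕtoℚ (n !))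
      × (Σ (FinPoset n) λ Q → (δbinom (δ n) n ≤ℚ ℕtoℚ (comp Q))
          × (((c * M (δ n) n) ^ℚ n) * ℕtoℚ (n !) ≤ℚ ℕtoℚ (e Q)))))
proposition4p4 δ 0<δ<1 _ = Bounds.1/24 , ℕtoℚ 24 , *<* (+<+ (s≤s z≤n)) , *<* (+<+ (s≤s z≤n)) , 1 ,
  λ { (suc m) _ → let (0<d , d<1) = 0<δ<1 (suc m) in
                  Bounds.upper (δ (suc m)) (<⇒≤ 0<d) (<⇒≤ d<1) m , Bounds.lower (δ (suc m)) (<⇒≤ 0<d) (<⇒≤ d<1) m }
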